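{- For every regular language $L$ over a finite alphabet $\Sigma$, the dynamic membership problem $\mathrm{Member}(L)$ is in $\mathrm{UDyn}\Sigma_2$, i.e., it can be maintained by a dynamic program that uses only auxiliary relations of arity at most $1$ and whose update formulas are all $\Sigma_2$-formulas (prenex formulas of the form $\exists^*\forall^*$ followed by a quantifier-free part).
   Context: Dynamic descriptive complexity (Patnaik–Immerman). A word $w=w_1\cdots w_n$ with each $w_i\in\Sigma\cup\{\epsilon\}$ is encoded as the structure with domain $\{1,\dots,n\}$, a unary relation $W_\sigma$ for each $\sigma\in\Sigma$ (the positions carrying $\sigma$; a position in no $W_\sigma$ carries $\epsilon$) and the linear order $\le$. The word represented is the concatenation of the non-$\epsilon$ symbols. Changes are $\mathrm{set}_\sigma(i)$ for $\sigma\in\Sigma\cup\{\epsilon\}$, setting position $i$ to $\sigma$. A dynamic program stores auxiliary relations over a relational schema; for each auxiliary relation symbol $R$ and each $\sigma$ it has an update formula $\varphi^R_\sigma(\bar x;y)$ over the input and auxiliary relations; after a change $\mathrm{set}_\sigma(i)$, the new $R$ consists of all tuples $\bar a$ such that $\varphi^R_\sigma(\bar a;i)$ holds in the structure formed by the changed word and the old auxiliary relations. The initial word is $\epsilon^n$ and the initial auxiliary relations are defined by a first-order formula. The program maintains $\mathrm{Member}(L)$ if a distinguished $0$-ary auxiliary relation is true exactly when the current word is in $L$, after every finite sequence of changes. For a class $\mathcal C$ of formulas, $\mathrm{UDyn}\mathcal C$ is the class of problems maintainable by such programs with all auxiliary relations of arity $\le 1$ and all update formulas in $\mathcal C$ (formulas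 in prenex normal form). -}

module Defs where

open import Data.Nat using (ℕ; zero; suc)
open import Data.Fin using (Fin; zero; suc; _≟_; _≤?_)
open import Data.Bool using (Bool; true; false; _∧_; _∨_; not)
open import Data.Maybe using (Maybe; just; nothing)
open import Data.List using (List; []; _∷_; catMaybes; foldl)
open import Data.Product using (Σ; _×_; _,_; proj₁; proj₂; ∃)
open import Relation.Nullary.Decidable using (⌊_⌋)
open import Function using (_⇔_)
import Data.Vec.Functional as VF
open import Relation.Binary.PropositionalEquality using (_≡_)

-- Alphabet Σ = Fin s.  A symbol of Σ ∪ {ε} is a  Maybe (Fin s)
-- (nothing = ε).

record DFA (s : ℕ) : Set where
  field
    states : ℕ
    start  : Fin states
    δ      : Fin states → Fin s → Fin states
    final  : Fin states → Bool

accepts : ∀ {s} → DFA s → List (Fin s) → Bool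
accepts D w = DFA.final D (foldl (DFA.δ D) (DFA.start D) w)

Regular : ∀ {s} → (List (Fin s) → Set) → Set
Regular {s} L = Σ (DFA s) λ D → ∀ w → L w ⇔ (accepts D w ≡ true)

-- First-order formulas over the schema
--   input:      W_σ (unary, σ ∈ Fin s), ≤ (binary), = (binary)
--   auxiliary:  k₀ nullary relations Z_j, k₁ unary relations U_j
-- with  v  free variables (de Bruijn, Fin v).

data Formula (s k₀ k₁ : ℕ) : ℕ → Set where
  W      : ∀ {v} → Fin s → Fin v → Formula s k₀ k₁ v
  leq    : ∀ {v} → Fin v → Fin v → Formula s k₀ k₁ v
  eq     : ∀ {v} → Fin v → Fin v → Formula s k₀ k₁ v
  Z      : ∀ {v} → Fin k₀ → Formula s k₀ k₁ v
  U      : ∀ {v} → Fin k₁ → Fin v → Formula s k₀ k₁ v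
  ⊤f ⊥f  : ∀ {v} → Formula s k₀ k₁ v
  ¬f     : ∀ {v} → Formula s k₀ k₁ v → Formula s k₀ k₁ v
  _∧f_   : ∀ {v} → Formula s k₀ k₁ v → Formula s k₀ k₁ v → Formula s k₀ k₁ v
  _∨f_   : ∀ {v} → Formula s k₀ k₁ v → Formula s k₀ k₁ v → Formula s k₀ k₁ v
  ∃f     : ∀ {v} → Formula s k₀ k₁ (suc v) → Formula s k₀ k₁ v
  ∀f     : ∀ {v} → Formula s k₀ k₁ (suc v) → Formula s k₀ k₁ v

data QF {s k₀ k₁ : ℕ} : ∀ {v} → Formula s k₀ k₁ v → Set where
  qW   : ∀ {v} σ (x : Fin v) → QF (W σ x)
  qleq : ∀ {v} (x y : Fin v) → QF (leq x y)
  qeq  : ∀ {v} (x y : Fin v) → QF (eq x y)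
  qZ   : ∀ {v} j → QF {v = v} (Z j)
  qU   : ∀ {v} j (x : Fin v) → QF (U j x)
  q⊤   : ∀ {v} → QF {v = v} ⊤f
  q⊥   : ∀ {v} → QF {v = v} ⊥f
  q¬   : ∀ {v} {φ : Formula s k₀ k₁ v} → QF φ → QF (¬f φ)
  q∧   : ∀ {v} {φ ψ : Formula s k₀ k₁ v} → QF φ → QF ψ → QF (φ ∧f ψ)
  q∨   : ∀ {v} {φ ψ : Formula s k₀ k₁ v} → QF φ → QF ψ → QF (φ ∨f ψ)

data Π₁ {s k₀ k₁ : ℕ} : ∀ {v} → Formula s k₀ k₁ v → Set where
  qf   : ∀ {v} {φ : Formula s k₀ k₁ v} → QF φ → Π₁ φ
  all  : ∀ {v} {φ : Formula s k₀ k₁ (suc v)} → Π₁ φ → Π₁ (∀f φ)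

data Σ₂ {s k₀ k₁ : ℕ} : ∀ {v} → Formula s k₀ k₁ v → Set where
  pi   : ∀ {v} {φ : Formula s k₀ k₁ v} → Π₁ φ → Σ₂ φ
  ex   : ∀ {v} {φ : Formula s k₀ k₁ (suc v)} → Σ₂ φ → Σ₂ (∃f φ)

anyFin allFin : ∀ {n} → (Fin n → Bool) → Bool
anyFin {zero}  f = false
anyFin {suc n} f = f zero ∨ anyFin (λ i → f (suc i))
allFin {zero}  f = true
allFin {suc n} f = f zero ∧ allFin (λ i → f (suc i))

Word : ℕ → ℕ → Set
Word s n = Fin n → Maybe (Fin s)

record Aux (k₀ k₁ n : ℕ) : Set where
  constructor aux
  field
    nul : Fin k₀ → Bool
    un  : Fin k₁ → Fin n → Bool

isSym : ∀ {s} → Maybe (Fin s) → Fin s → Bool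
isSym nothing  σ = false
isSym (just τ) σ = ⌊ τ ≟ σ ⌋

eval : ∀ {s k₀ k₁ n v} → Word s n → Aux k₀ k₁ n →
       Formula s k₀ k₁ v → (Fin v → Fin n) → Bool
eval w A (W σ x)   ρ = isSym (w (ρ x)) σ
eval w A (leq x y) ρ = ⌊ ρ x ≤? ρ y ⌋
eval w A (eq x y)  ρ = ⌊ ρ x ≟ ρ y ⌋
eval w A (Z j)     ρ = Aux.nul A j
eval w A (U j x)   ρ = Aux.un A j (ρ x)
eval w A ⊤f        ρ = true
eval w A ⊥f        ρ = false
eval w A (¬f φ)    ρ = not (eval w A φ ρ)
eval w A (φ ∧f ψ)  ρ = eval w A φ ρ ∧ eval w A ψ ρ
eval w A (φ ∨f ψ)  ρ = eval w A φ ρ ∨ eval w A ψ ρ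
eval w A (∃f φ)    ρ = anyFin λ a → eval w A φ (a VF.∷ ρ)
eval w A (∀f φ)    ρ = allFin λ a → eval w A φ (a VF.∷ ρ)

-- Dynamic programs with auxiliary relations of arity ≤ 1.
-- Variable 0 of an update formula for a unary relation is x,
-- variable 1 is the changed position y; a nullary update formula
-- has the single free variable y.

record DynProg (s k₀ k₁ : ℕ) : Set where
  field
    -- initialisation: FO formulas over the input schema (no aux relations),
    -- evaluated on the initial word ε^n
    init₀ : Fin k₀ → Formula s 0 0 0
    init₁ : Fin k₁ → Formula s 0 0 1
    upd₀  : Fin k₀ → Maybe (Fin s) → Formula s k₀ k₁ 1
    upd₁  : Fin k₁ → Maybe (Fin s) → Formula s k₀ k₁ 2
    acc   : Fin k₀

UpdatesΣ₂ : ∀ {s k₀ k₁} → DynProg s k₀ k₁ → Set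
UpdatesΣ₂ P = (∀ j σ → Σ₂ (DynProg.upd₀ P j σ)) × (∀ j σ → Σ₂ (DynProg.upd₁ P j σ))

emptyWord : ∀ {s n} → Word s n
emptyWord _ = nothing

noAux : ∀ {n} → Aux 0 0 n
noAux = aux (λ ()) (λ ())

initAux : ∀ {s k₀ k₁} → DynProg s k₀ k₁ → (n : ℕ) → Aux k₀ k₁ n
initAux {s} P n =
  aux (λ j → eval {s} {n = n} emptyWord noAux (DynProg.init₀ P j) (λ ()))
      (λ j a → eval {s} {n = n} emptyWord noAux (DynProg.init₁ P j) (λ _ → a))

Change : ℕ → ℕ → Set
Change s n = Fin n × Maybe (Fin s)

setWord : ∀ {s n} → Word s n → Change s n → Word s n
setWord w (i , σ) j with ⌊ j ≟ i ⌋
... | true  = σ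
... | false = w j

step : ∀ {s k₀ k₁ n} → DynProg s k₀ k₁ →
       Word s n × Aux k₀ k₁ n → Change s n → Word s n × Aux k₀ k₁ n
step P (w , A) (i , σ) =
  let w' = setWord w (i , σ) in
  w' , aux (λ j → eval w' A (DynProg.upd₀ P j σ) (λ _ → i))
           (λ j a → eval w' A (DynProg.upd₁ P j σ) (a VF.∷ (λ _ → i)))

run : ∀ {s k₀ k₁} → DynProg s k₀ k₁ → (n : ℕ) → List (Change s n) →
      Word s n × Aux k₀ k₁ n
run P n cs = foldl (step P) (emptyWord , initAux P n) cs

wordOf : ∀ {s n} → Word s n → List (Fin s)
wordOf w = catMaybes (VF.toList w)

Maintains : ∀ {s k₀ k₁} → DynProg s k₀ k₁ → (List (Fin s) → Set) → Set
Maintains P L = ∀ n (cs : List (Change _ n)) →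
  let st = run P n cs in
  (Aux.nul (proj₂ st) (DynProg.acc P) ≡ true) ⇔ L (wordOf (proj₁ st))

InUDynΣ₂ : ∀ {s} → (List (Fin s) → Set) → Set
InUDynΣ₂ {s} L =
  Σ ℕ λ k₀ → Σ ℕ λ k₁ → Σ (DynProg s k₀ k₁) λ P → UpdatesΣ₂ P × Maintains P L

-- For a prefix of length j of the current word, let O j be the following order
-- of the k states: O 0 lists the initial state first, and O (j+1) lists the
-- images of the states of O j under the letter at position j, in order and
-- without repetitions, followed by the states outside that image.  The head of
-- O n is the state the automaton reaches on the whole word, so membership is
-- read off O n.  At every position a the program stores, as 2k² unary
-- relations, which state has which rank in O a and in O (a+1).
--
-- When position y changes, O j is unchanged for j ≤ y.  For x ≥ y the new
-- O (x+1) lists the images, under the composition g of the letters y+1, …, x,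
-- of the states of the new O (y+1), followed by the remaining states in their
-- old order: the image under g of a list containing every state does not
-- depend on the list.  To evaluate g in a Σ₂ formula, follow the rank in the
-- old orders of the image of a state p along the positions after y.  This rank
-- never increases, so it is described by k existentially guessed positions,
-- one for each threshold t, at which it drops to at most t; a universally
-- quantified position then checks every step of every path against the
-- stored orders.

module Submission where

open import Data.Nat using (ℕ)
open import Data.Fin using (Fin)
open import Data.List using (List)
open import Data.Product using (_,_)
import Defs

module Booleans where

  open import Data.Bool.Base using (Bool; true; false; T; not; _∧_; _∨_; if_then_else_)
  open import Data.Empty using (⊥-elim)
  open import Data.Fin.Base using (Fin; zero; suc; toℕ)
  open import Data.Nat.Base using (ℕ; zero; suc; _+_; _≤_; _<_; _≤ᵇ_; _<ᵇ_; z≤n; s≤s)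
  open import Data.Nat.Properties
    using (≤ᵇ⇒≤; ≤⇒≤ᵇ; ≰⇒>; <⇒≱; ≤-refl; ≤-trans; m≤n⇒m≤1+n; m≤n⇒m<n∨m≡n; <-irrefl)
  open import Data.Product using (∃; _,_)
  open import Data.Sum using (inj₁; inj₂)
  open import Function using (_∘_; _⇔_; mk⇔; Equivalence)
  open import Relation.Binary.PropositionalEquality
  open import Relation.Nullary using (¬_; Dec; yes; no; does; contradiction)
  open Defs using (anyFin; allFin)
  open Equivalence using (to; from)

  bool-ext : ∀ {a b} → (T a → T b) → (T b → T a) → a ≡ b
  bool-ext {false} {false} _ _ = refl
  bool-ext {false} {true}  _ g = ⊥-elim (g _)
  bool-ext {true}  {false} f _ = ⊥-elim (f _)
  bool-ext {true}  {true}  _ _ = refl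

  T-not : ∀ {a} → T (not a) ⇔ (¬ T a)
  T-not {false} = mk⇔ (λ _ ()) (λ _ → _)
  T-not {true}  = mk⇔ (λ ()) (λ ¬t → ¬t _)

  T-does : ∀ {p} {P : Set p} (P? : Dec P) → T (does P?) ⇔ P
  T-does (yes p) = mk⇔ (λ _ → p) (λ _ → _)
  T-does (no ¬p) = mk⇔ (λ ()) ¬p

  ¬T-not⇒T : ∀ {a} → ¬ T (not a) → T a
  ¬T-not⇒T {false} ¬t = ¬t _
  ¬T-not⇒T {true}  _  = _

  if-cong₃ : ∀ {A : Set} {c c' : Bool} {a a' b b' : A} → c ≡ c' → a ≡ a' → b ≡ b' →
             (if c then a else b) ≡ (if c' then a' else b')
  if-cong₃ refl refl refl = refl

  infixr 4 _→ᵇ_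
  _→ᵇ_ : Bool → Bool → Bool
  a →ᵇ b = not a ∨ b

  T-→ᵇ : ∀ {a b} → T (a →ᵇ b) ⇔ (T a → T b)
  T-→ᵇ {false} = mk⇔ (λ _ ()) (λ _ → _)
  T-→ᵇ {true}  = mk⇔ (λ t _ → t) (λ f → f _)

  T-≤ᵇ : ∀ {m n} → T (m ≤ᵇ n) ⇔ m ≤ n
  T-≤ᵇ {m} {n} = mk⇔ (≤ᵇ⇒≤ m n) ≤⇒≤ᵇ

  T-not-≤ᵇ : ∀ {m n} → T (not (n ≤ᵇ m)) ⇔ m < n
  T-not-≤ᵇ {m} {n} = mk⇔ (λ t → ≰⇒> (to T-not t ∘ ≤⇒≤ᵇ))
                         (λ m<n → from T-not (<⇒≱ m<n ∘ ≤ᵇ⇒≤ n m))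

  T-allFin : ∀ {n} (f : Fin n → Bool) → T (allFin f) ⇔ (∀ a → T (f a))
  T-allFin {zero}  f = mk⇔ (λ _ ()) (λ _ → _)
  T-allFin {suc n} f with f zero in eq
  ... | false = mk⇔ (λ ()) (λ all → subst T eq (all zero))
  ... | true  = mk⇔ (λ { t zero → subst T (sym eq) _ ; t (suc a) → to (T-allFin (f ∘ suc)) t a })
                    (λ all → from (T-allFin (f ∘ suc)) (all ∘ suc))

  T-anyFin : ∀ {n} (f : Fin n → Bool) → T (anyFin f) ⇔ ∃ λ a → T (f a)
  T-anyFin {zero}  f = mk⇔ (λ ()) (λ ())
  T-anyFin {suc n} f with f zero in eq
  ... | true  = mk⇔ (λ _ → zero , subst T (sym eq) _) (λ _ → _)
  ... | false = mk⇔ (λ t → let (a , fa) = to (T-anyFin (f ∘ suc)) t in suc a , fa)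
                    λ { (zero , fa)  → ⊥-elim (subst T eq fa)
                      ; (suc a , fa) → from (T-anyFin (f ∘ suc)) (a , fa) }

  allFin-cong : ∀ {n} {f g : Fin n → Bool} → (∀ a → f a ≡ g a) → allFin f ≡ allFin g
  allFin-cong {zero}  eq = refl
  allFin-cong {suc n} eq = cong₂ _∧_ (eq zero) (allFin-cong (eq ∘ suc))

  count : ∀ {m} → (Fin m → Bool) → ℕ
  count {zero}  h = 0
  count {suc m} h = (if h zero then 1 else 0) + count (h ∘ suc)

  count-cong : ∀ {m} {h h' : Fin m → Bool} → (∀ t → h t ≡ h' t) → count h ≡ count h'
  count-cong {zero}  eq = refl
  count-cong {suc m} eq = cong₂ (λ b c → (if b then 1 else 0) + c) (eq zero) (count-cong (eq ∘ suc))

  count-<ᵇ : ∀ {m} c → c ≤ m → count {m} (λ t → toℕ t <ᵇ c) ≡ c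
  count-<ᵇ {zero}  zero    _         = refl
  count-<ᵇ {suc m} zero    _         = count-<ᵇ {m} zero z≤n
  count-<ᵇ {suc m} (suc c) (s≤s c≤m) = cong suc (count-<ᵇ c c≤m)

  lastTrue : (ℕ → Bool) → ℕ → ℕ
  lastTrue P zero    = zero
  lastTrue P (suc m) = if P (suc m) then suc m else lastTrue P m

  lastTrue≤ : ∀ P m → lastTrue P m ≤ m
  lastTrue≤ P zero    = z≤n
  lastTrue≤ P (suc m) with P (suc m)
  ... | true  = ≤-refl
  ... | false = m≤n⇒m≤1+n (lastTrue≤ P m)

  module _ (P : ℕ → Bool) (down : ∀ j → T (P (suc j)) → T (P j)) where

    downward : ∀ {a j} → T (P a) → j ≤ a → T (P j)
    downward pa j≤a with m≤n⇒m<n∨m≡n j≤a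
    downward {suc a} pa _ | inj₁ (s≤s j≤a) = downward (down a pa) j≤a
    ... | inj₂ refl = pa

    lastTrue-spec : T (P 0) → ∀ m {j} → j ≤ m → T (P j) ⇔ j ≤ lastTrue P m
    lastTrue-spec p0 zero    z≤n = mk⇔ (λ _ → z≤n) (λ _ → p0)
    lastTrue-spec p0 (suc m) {j} j≤ with P (suc m) in eq
    ... | true  = mk⇔ (λ _ → j≤) (λ _ → downward (subst T (sym eq) _) j≤)
    ... | false with m≤n⇒m<n∨m≡n j≤
    ...   | inj₁ (s≤s j≤m) = lastTrue-spec p0 m j≤m
    ...   | inj₂ refl      = mk⇔ (λ t → ⊥-elim (subst T eq t))
                                 (λ m<m → contradiction (≤-trans m<m (lastTrue≤ P m)) (<-irrefl refl))

module Lists where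

  open import Data.Bool.Base using (if_then_else_)
  open import Data.Fin.Base using (Fin; zero; suc; toℕ)
  open import Data.Fin.Properties using (injective⇒≤)
  open import Data.List.Base using (List; []; _∷_; _++_; map; filter; deduplicate; length; tabulate; lookup)
  open import Data.List.Membership.Propositional using (_∈_; _∉_)
  open import Data.List.Membership.Propositional.Properties
    using (∈-lookup; ∈-deduplicate⁺; ∈-deduplicate⁻)
  open import Data.List.Properties using (filter-++; filter-≐; filter-all; filter-idem)
  open import Data.List.Relation.Unary.All as All using (All; []; _∷_)
  open import Data.List.Relation.Unary.AllPairs using ([]; _∷_)
  open import Data.List.Relation.Unary.Any using (Any; here; there; index)
  open import Data.List.Relation.Unary.Any.Properties using (lookup-index)
  open import Data.List.Relation.Unary.Unique.Propositional using (Unique)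
  open import Data.List.Relation.Unary.Unique.DecPropositional.Properties using (deduplicate-!)
  open import Data.Nat.Base using (ℕ; zero; suc; _≤_; _<_; z≤n; s≤s)
  open import Data.Nat.Properties using (≤-trans; ≤-antisym; m≤n⇒m≤1+n)
  open import Data.Product using (_×_; _,_; proj₁; proj₂)
  open import Function using (_∘_)
  open import Level using (Level)
  open import Relation.Binary.Definitions using (DecidableEquality)
  open import Relation.Binary.PropositionalEquality
  open import Relation.Nullary using (¬_; yes; no; does; ¬?; contradiction)
  open import Relation.Unary using (Pred; Decidable; _≐_)
  open import Relation.Unary.Properties using (_∩?_)

  private
    variable
      a p q r : Level
      A : Set a

  filter-filter : ∀ {P : Pred A p} {Q : Pred A q} {R : Pred A r}
                  (P? : Decidable P) (Q? : Decidable Q) (R? : Decidable R) →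
                  (∀ {x} → R x → P x × Q x) → (∀ {x} → P x → Q x → R x) →
                  ∀ xs → filter P? (filter Q? xs) ≡ filter R? xs
  filter-filter P? Q? R? R⇒ ⇒R [] = refl
  filter-filter P? Q? R? R⇒ ⇒R (x ∷ xs) with Q? x | R? x
  ... | no ¬qx | yes rx = contradiction (proj₂ (R⇒ rx)) ¬qx
  ... | no _   | no _   = filter-filter P? Q? R? R⇒ ⇒R xs
  ... | yes qx | rx? with P? x | rx?
  ...   | yes px | yes _  = cong (x ∷_) (filter-filter P? Q? R? R⇒ ⇒R xs)
  ...   | yes px | no ¬rx = contradiction (⇒R px qx) ¬rx
  ...   | no ¬px | yes rx = contradiction (proj₁ (R⇒ rx)) ¬px
  ...   | no _   | no _   = filter-filter P? Q? R? R⇒ ⇒R xs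

  filter-comm : ∀ {P : Pred A p} {Q : Pred A q} (P? : Decidable P) (Q? : Decidable Q) →
                ∀ xs → filter P? (filter Q? xs) ≡ filter Q? (filter P? xs)
  filter-comm P? Q? xs = trans (filter-filter P? Q? (P? ∩? Q?) (λ pq → pq) _,_ xs)
                               (sym (filter-filter Q? P? (P? ∩? Q?) (λ (px , qx) → qx , px) (λ qx px → px , qx) xs))

  filter-map : ∀ {B : Set a} {P : Pred B p} (P? : Decidable P) (f : A → B) xs →
               filter P? (map f xs) ≡ map f (filter (P? ∘ f) xs)
  filter-map P? f [] = refl
  filter-map P? f (x ∷ xs) with P? (f x)
  ... | yes _ = cong (f x ∷_) (filter-map P? f xs)
  ... | no _  = filter-map P? f xs

  lookup-injective : ∀ {xs : List A} → Unique xs → ∀ {i j} → lookup xs i ≡ lookup xs j → i ≡ j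
  lookup-injective (_ ∷ _)  {zero}  {zero}  _  = refl
  lookup-injective (x≢ ∷ _) {zero}  {suc j} eq = contradiction eq (All.lookup x≢ (∈-lookup j))
  lookup-injective (x≢ ∷ _) {suc i} {zero}  eq = contradiction (sym eq) (All.lookup x≢ (∈-lookup i))
  lookup-injective (_ ∷ u)  {suc i} {suc j} eq = cong suc (lookup-injective u eq)

  nth : A → List A → ℕ → A
  nth d []       _       = d
  nth d (x ∷ xs) zero    = x
  nth d (x ∷ xs) (suc j) = nth d xs j

  tabulate-nth : ∀ {m} (d : A) xs → length xs ≡ m → tabulate {n = m} (nth d xs ∘ toℕ) ≡ xs
  tabulate-nth d []       refl = refl
  tabulate-nth d (x ∷ xs) refl = cong (x ∷_) (tabulate-nth d xs refl)

  module WithDecidableEquality (_≟_ : DecidableEquality A) where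

    open import Data.List.Membership.DecPropositional _≟_ using (_∉?_)

    dedup : List A → List A
    dedup = deduplicate _≟_

    private
      _≢?_ : ∀ x → Decidable (λ y → ¬ x ≡ y)
      (x ≢? y) = ¬? (x ≟ y)

    filter-dedup : ∀ {P : Pred A p} (P? : Decidable P) xs → filter P? (dedup xs) ≡ dedup (filter P? xs)
    filter-dedup P? []       = refl
    filter-dedup {P = P} P? (x ∷ xs) with P? x
    ... | yes _  = cong (x ∷_) (trans (filter-comm P? (x ≢?_) (dedup xs)) (cong (filter (x ≢?_)) (filter-dedup P? xs)))
    ... | no ¬px = trans (filter-filter P? (x ≢?_) P? (λ py → py , x≢ py) (λ py _ → py) (dedup xs)) (filter-dedup P? xs)
      where
      x≢ : ∀ {y} → P y → ¬ x ≡ y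
      x≢ py x≡y = ¬px (subst P (sym x≡y) py)

    dedup-++ : ∀ xs ys → dedup (xs ++ ys) ≡ dedup xs ++ filter (_∉? xs) (dedup ys)
    dedup-++ []       ys = sym (filter-all (_∉? []) (All.tabulate λ _ ()))
    dedup-++ (x ∷ xs) ys = cong (x ∷_) (begin
      filter (x ≢?_) (dedup (xs ++ ys))
        ≡⟨ cong (filter (x ≢?_)) (dedup-++ xs ys) ⟩
      filter (x ≢?_) (dedup xs ++ filter (_∉? xs) (dedup ys))
        ≡⟨ filter-++ (x ≢?_) (dedup xs) _ ⟩
      filter (x ≢?_) (dedup xs) ++ filter (x ≢?_) (filter (_∉? xs) (dedup ys))
        ≡⟨ cong (filter (x ≢?_) (dedup xs) ++_)
                (filter-filter (x ≢?_) (_∉? xs) (_∉? x ∷ xs) split join (dedup ys)) ⟩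
      filter (x ≢?_) (dedup xs) ++ filter (_∉? x ∷ xs) (dedup ys) ∎)
      where
      open ≡-Reasoning
      split : ∀ {y} → y ∉ x ∷ xs → ¬ x ≡ y × y ∉ xs
      split y∉ = (λ x≡y → y∉ (here (sym x≡y))) , (λ y∈ → y∉ (there y∈))
      join : ∀ {y} → ¬ x ≡ y → y ∉ xs → y ∉ x ∷ xs
      join x≢y _   (here y≡x)  = x≢y (sym y≡x)
      join _   y∉xs (there y∈) = y∉xs y∈

    dedup-idem : ∀ xs → dedup (dedup xs) ≡ dedup xs
    dedup-idem []       = refl
    dedup-idem (x ∷ xs) = cong (x ∷_) (begin
      filter (x ≢?_) (dedup (filter (x ≢?_) (dedup xs)))
        ≡⟨ cong (filter (x ≢?_)) (filter-dedup (x ≢?_) (dedup xs)) ⟨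
      filter (x ≢?_) (filter (x ≢?_) (dedup (dedup xs)))
        ≡⟨ filter-idem (x ≢?_) (dedup (dedup xs)) ⟩
      filter (x ≢?_) (dedup (dedup xs))
        ≡⟨ cong (filter (x ≢?_)) (dedup-idem xs) ⟩
      filter (x ≢?_) (dedup xs) ∎)
      where open ≡-Reasoning

    dedup-map-dedup : ∀ (f : A → A) xs → dedup (map f (dedup xs)) ≡ dedup (map f xs)
    dedup-map-dedup f []       = refl
    dedup-map-dedup f (x ∷ xs) = cong (f x ∷_) (begin
      filter (f x ≢?_) (dedup (map f (filter (x ≢?_) D)))
        ≡⟨ filter-dedup (f x ≢?_) (map f (filter (x ≢?_) D)) ⟩
      dedup (filter (f x ≢?_) (map f (filter (x ≢?_) D)))
        ≡⟨ cong dedup (filter-map (f x ≢?_) f (filter (x ≢?_) D)) ⟩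
      dedup (map f (filter ((f x ≢?_) ∘ f) (filter (x ≢?_) D)))
        ≡⟨ cong (dedup ∘ map f)
                (filter-filter ((f x ≢?_) ∘ f) (x ≢?_) ((f x ≢?_) ∘ f) fx≢ (λ p _ → p) D) ⟩
      dedup (map f (filter ((f x ≢?_) ∘ f) D))
        ≡⟨ cong dedup (filter-map (f x ≢?_) f D) ⟨
      dedup (filter (f x ≢?_) (map f D))
        ≡⟨ filter-dedup (f x ≢?_) (map f D) ⟨
      filter (f x ≢?_) (dedup (map f D))
        ≡⟨ cong (filter (f x ≢?_)) (dedup-map-dedup f xs) ⟩
      filter (f x ≢?_) (dedup (map f xs)) ∎)
      where
      open ≡-Reasoning
      D = dedup xs
      fx≢ : ∀ {y} → ¬ f x ≡ f y → ¬ f x ≡ f y × ¬ x ≡ y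
      fx≢ ne = ne , λ x≡y → ne (cong f x≡y)

    dedup-dedup-++ : ∀ xs ys → dedup (dedup xs ++ ys) ≡ dedup (xs ++ ys)
    dedup-dedup-++ xs ys = begin
      dedup (dedup xs ++ ys)
        ≡⟨ dedup-++ (dedup xs) ys ⟩
      dedup (dedup xs) ++ filter (_∉? dedup xs) (dedup ys)
        ≡⟨ cong₂ _++_ (dedup-idem xs) (filter-≐ _ _ ∉-dedup (dedup ys)) ⟩
      dedup xs ++ filter (_∉? xs) (dedup ys)
        ≡⟨ dedup-++ xs ys ⟨
      dedup (xs ++ ys) ∎
      where
      open ≡-Reasoning
      ∉-dedup : (_∉ dedup xs) ≐ (_∉ xs)
      ∉-dedup = (λ y∉ y∈ → y∉ (∈-deduplicate⁺ _≟_ y∈))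
              , (λ y∉ y∈ → y∉ (∈-deduplicate⁻ _≟_ xs y∈))

    dedup-map-dedup-++ : ∀ (f : A → A) xs ys → dedup (map f (dedup xs) ++ ys) ≡ dedup (map f xs ++ ys)
    dedup-map-dedup-++ f xs ys = begin
      dedup (map f (dedup xs) ++ ys)          ≡⟨ dedup-dedup-++ (map f (dedup xs)) ys ⟨
      dedup (dedup (map f (dedup xs)) ++ ys)  ≡⟨ cong (λ l → dedup (l ++ ys)) (dedup-map-dedup f xs) ⟩
      dedup (dedup (map f xs) ++ ys)          ≡⟨ dedup-dedup-++ (map f xs) ys ⟩
      dedup (map f xs ++ ys)                  ∎
      where open ≡-Reasoning

    indexOf : A → List A → ℕ
    indexOf q []       = 0
    indexOf q (y ∷ ys) = if does (q ≟ y) then 0 else suc (indexOf q ys)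

    nth-indexOf : ∀ d {q} xs → q ∈ xs → nth d xs (indexOf q xs) ≡ q
    nth-indexOf d {q} (y ∷ ys) q∈ with q ≟ y | q∈
    ... | yes q≡y | _         = sym q≡y
    ... | no q≢y  | here q≡y  = contradiction q≡y q≢y
    ... | no _    | there q∈' = nth-indexOf d ys q∈'

    indexOf<length : ∀ {q} xs → q ∈ xs → indexOf q xs < length xs
    indexOf<length {q} (y ∷ ys) q∈ with q ≟ y | q∈
    ... | yes _   | _         = s≤s z≤n
    ... | no q≢y  | here q≡y  = contradiction q≡y q≢y
    ... | no _    | there q∈' = s≤s (indexOf<length ys q∈')

    indexOf-filter : ∀ {P : Pred A p} (P? : Decidable P) {q} → P q →
                     ∀ xs → indexOf q (filter P? xs) ≤ indexOf q xs
    indexOf-filter P? pq []       = z≤n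
    indexOf-filter {P = P} P? {q} pq (y ∷ ys) with P? y
    ... | yes _ with q ≟ y
    ...   | yes _ = z≤n
    ...   | no _  = s≤s (indexOf-filter P? pq ys)
    indexOf-filter {P = P} P? {q} pq (y ∷ ys) | no ¬py with q ≟ y
    ...   | yes q≡y = contradiction (subst P q≡y pq) ¬py
    ...   | no _    = m≤n⇒m≤1+n (indexOf-filter P? pq ys)

    indexOf-dedup : ∀ q xs → indexOf q (dedup xs) ≤ indexOf q xs
    indexOf-dedup q []       = z≤n
    indexOf-dedup q (y ∷ ys) with q ≟ y
    ... | yes _   = z≤n
    ... | no q≢y  = s≤s (≤-trans (indexOf-filter (y ≢?_) (q≢y ∘ sym) (dedup ys)) (indexOf-dedup q ys))

    indexOf-++ : ∀ {q} xs ys → q ∈ xs → indexOf q (xs ++ ys) ≡ indexOf q xs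
    indexOf-++ {q} (x ∷ xs) ys q∈ with q ≟ x | q∈
    ... | yes _  | _         = refl
    ... | no q≢x | here q≡x  = contradiction q≡x q≢x
    ... | no _   | there q∈' = cong suc (indexOf-++ xs ys q∈')

    indexOf-map : ∀ (f : A → A) q xs → indexOf (f q) (map f xs) ≤ indexOf q xs
    indexOf-map f q []       = z≤n
    indexOf-map f q (y ∷ ys) with q ≟ y | f q ≟ f y
    ... | _       | yes _    = z≤n
    ... | yes q≡y | no fq≢fy = contradiction (cong f q≡y) fq≢fy
    ... | no _    | no _     = s≤s (indexOf-map f q ys)

  module _ {k : ℕ} where

    open import Data.Fin.Properties using (_≟_)
    open WithDecidableEquality (_≟_ {k})

    Complete : List (Fin k) → Set
    Complete xs = ∀ q → q ∈ xs

    length-unique : ∀ {xs} → Unique xs → length xs ≤ k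
    length-unique u = injective⇒≤ (lookup-injective u)

    length-complete : ∀ {xs} → Complete xs → k ≤ length xs
    length-complete {xs} c = injective⇒≤ {f = index ∘ c} λ {p} {q} eq →
      trans (lookup-index (c p)) (trans (cong (lookup xs) eq) (sym (lookup-index (c q))))

    length-dedup-complete : ∀ xs → Complete xs → length (dedup xs) ≡ k
    length-dedup-complete xs c =
      ≤-antisym (length-unique (deduplicate-! _≟_ xs)) (length-complete (∈-deduplicate⁺ _≟_ ∘ c))

module Orders (k : ℕ) (start : Fin k) where

  open import Data.Fin.Base using (Fin; zero; suc)
  open import Data.Fin.Properties using (_≟_)
  open import Data.List.Base using (List; []; _∷_; _++_; map; filter; length; allFin)
  open import Data.List.Membership.Propositional using (_∈_; _∉_)
  open import Data.List.Membership.Propositional.Properties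
    using (∈-map⁺; ∈-map⁻; ∈-tabulate⁺; ∈-++⁺ʳ; ∈-deduplicate⁺; ∈-deduplicate⁻)
  open import Data.List.Properties
    using (map-++; map-∘; map-id; map-cong; ++-identityʳ; ++-assoc; filter-++; filter-none)
  open import Data.List.Relation.Unary.All as All using (All)
  open import Data.List.Relation.Unary.Any using (there)
  open import Data.Nat.Base using (ℕ; zero; suc; _+_; _≤_; _<_)
  open import Data.Nat.Properties using (≤-refl; m≤m+n; m≤n⇒m≤1+n; +-identityʳ; +-suc; module ≤-Reasoning)
  open import Data.Product using (∃; _×_; _,_)
  open import Function using (_∘_; id)
  open import Relation.Binary.PropositionalEquality
  open Lists

  open WithDecidableEquality (_≟_ {k})
  open import Data.List.Membership.DecPropositional (_≟_ {k}) using (_∉?_)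

  Step : Set
  Step = Fin k → Fin k

  advance : Step → List (Fin k) → List (Fin k)
  advance f L = dedup (map f L ++ allFin k)

  initialOrder : List (Fin k)
  initialOrder = dedup (start ∷ allFin k)

  order : (ℕ → Step) → ℕ → List (Fin k)
  order fs zero    = initialOrder
  order fs (suc j) = advance (fs j) (order fs j)

  reached : (ℕ → Step) → ℕ → Fin k
  reached fs zero    = start
  reached fs (suc j) = fs j (reached fs j)

  compose : (ℕ → Step) → ℕ → ℕ → Step
  compose fs a zero    = id
  compose fs a (suc m) = fs (a + m) ∘ compose fs a m

  compose-suc : ∀ fs a m q → compose fs a (suc m) q ≡ compose fs (suc a) m (fs a q)
  compose-suc fs a zero    q = cong (λ j → fs j q) (+-identityʳ a)
  compose-suc fs a (suc m) q = cong₂ fs (+-suc a m) (compose-suc fs a m q)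

  compose-shift : ∀ fs a m q → compose (fs ∘ suc) a m q ≡ compose fs (suc a) m q
  compose-shift fs a zero    q = refl
  compose-shift fs a (suc m) q = cong (fs (suc (a + m))) (compose-shift fs a m q)

  restarts : (ℕ → Step) → ℕ → ℕ → List (Fin k)
  restarts fs a zero    = []
  restarts fs a (suc m) = map (fs (a + m)) (restarts fs a m) ++ allFin k

  reorder : Step → List (Fin k) → List (Fin k) → List (Fin k)
  reorder g L old = dedup (map g L) ++ filter (_∉? map g L) old

  complete-dedup : ∀ {xs} → Complete xs → Complete (dedup xs)
  complete-dedup c q = ∈-deduplicate⁺ _≟_ (c q)

  advance-complete : ∀ f L → Complete (advance f L)
  advance-complete f L = complete-dedup (λ q → ∈-++⁺ʳ (map f L) (∈-tabulate⁺ q))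

  order-complete : ∀ fs j → Complete (order fs j)
  order-complete fs zero    = complete-dedup (λ q → there (∈-tabulate⁺ q))
  order-complete fs (suc j) = advance-complete (fs j) (order fs j)

  order-length : ∀ fs j → length (order fs j) ≡ k
  order-length fs zero    = length-dedup-complete _ λ q → there (∈-tabulate⁺ q)
  order-length fs (suc j) = length-dedup-complete _ λ q → ∈-++⁺ʳ (map (fs j) (order fs j)) (∈-tabulate⁺ q)

  order-dedup : ∀ fs j → dedup (order fs j) ≡ order fs j
  order-dedup fs zero    = dedup-idem (start ∷ allFin k)
  order-dedup fs (suc j) = dedup-idem (map (fs j) (order fs j) ++ allFin k)

  order-head : ∀ fs j → ∃ λ rest → order fs j ≡ reached fs j ∷ rest
  order-head fs zero    = _ , refl
  order-head fs (suc j) with order fs j | order-head fs j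
  ... | _ | _ , refl = _ , refl

  advance-cong : ∀ {f g} → (∀ q → f q ≡ g q) → ∀ L → advance f L ≡ advance g L
  advance-cong f≗g L = cong (λ l → dedup (l ++ allFin k)) (map-cong f≗g L)

  order-cong : ∀ {fs fs'} j → (∀ i → i < j → ∀ q → fs i q ≡ fs' i q) → order fs j ≡ order fs' j
  order-cong zero    _  = refl
  order-cong {fs} {fs'} (suc j) eq = trans (advance-cong (eq j ≤-refl) (order fs j))
    (cong (advance (fs' j)) (order-cong j λ i i<j → eq i (m≤n⇒m≤1+n i<j)))

  compose-cong : ∀ {fs fs'} a → (∀ i → a ≤ i → ∀ q → fs i q ≡ fs' i q) →
                 ∀ m q → compose fs a m q ≡ compose fs' a m q
  compose-cong a eq zero    q = refl
  compose-cong {fs} {fs'} a eq (suc m) q =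
    trans (eq (a + m) (m≤m+n a m) _) (cong (fs' (a + m)) (compose-cong a eq m q))

  restarts-cong : ∀ {fs fs'} a → (∀ i → a ≤ i → ∀ q → fs i q ≡ fs' i q) →
                  ∀ m → restarts fs a m ≡ restarts fs' a m
  restarts-cong a eq zero    = refl
  restarts-cong {fs} {fs'} a eq (suc m) = cong (_++ allFin k)
    (trans (map-cong (eq (a + m) (m≤m+n a m)) _) (cong (map (fs' (a + m))) (restarts-cong a eq m)))

  reorder-cong : ∀ {g g'} → (∀ q → g q ≡ g' q) → ∀ L old → reorder g L old ≡ reorder g' L old
  reorder-cong g≗g' L old = cong (λ l → dedup l ++ filter (_∉? l) old) (map-cong g≗g' L)

  order-+ : ∀ fs a m → order fs (a + m) ≡ dedup (map (compose fs a m) (order fs a) ++ restarts fs a m)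
  order-+ fs a zero = begin
    order fs (a + 0)                         ≡⟨ cong (order fs) (+-identityʳ a) ⟩
    order fs a                               ≡⟨ order-dedup fs a ⟨
    dedup (order fs a)                       ≡⟨ cong dedup (trans (sym (map-id _)) (sym (++-identityʳ _))) ⟩
    dedup (map id (order fs a) ++ [])        ∎
    where open ≡-Reasoning
  order-+ fs a (suc m) = begin
    order fs (a + suc m)
      ≡⟨ cong (order fs) (+-suc a m) ⟩
    advance f (order fs (a + m))
      ≡⟨ cong (advance f) (order-+ fs a m) ⟩
    dedup (map f (dedup (map g O ++ Z)) ++ allFin k)
      ≡⟨ dedup-map-dedup-++ f (map g O ++ Z) (allFin k) ⟩
    dedup (map f (map g O ++ Z) ++ allFin k)
      ≡⟨ cong (λ l → dedup (l ++ allFin k)) (map-++ f (map g O) Z) ⟩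
    dedup ((map f (map g O) ++ map f Z) ++ allFin k)
      ≡⟨ cong dedup (++-assoc (map f (map g O)) (map f Z) (allFin k)) ⟩
    dedup (map f (map g O) ++ (map f Z ++ allFin k))
      ≡⟨ cong (λ l → dedup (l ++ (map f Z ++ allFin k))) (map-∘ O) ⟨
    dedup (map (f ∘ g) O ++ (map f Z ++ allFin k)) ∎
    where
    open ≡-Reasoning
    f = fs (a + m)
    g = compose fs a m
    O = order fs a
    Z = restarts fs a m

  indexOf-advance : ∀ f p L → p ∈ L → indexOf (f p) (advance f L) ≤ indexOf p L
  indexOf-advance f p L p∈L = begin
    indexOf (f p) (dedup (map f L ++ allFin k))  ≤⟨ indexOf-dedup (f p) (map f L ++ allFin k) ⟩
    indexOf (f p) (map f L ++ allFin k)          ≡⟨ indexOf-++ (map f L) (allFin k) (∈-map⁺ f p∈L) ⟩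
    indexOf (f p) (map f L)                      ≤⟨ indexOf-map f p L ⟩
    indexOf p L                                  ∎
    where open ≤-Reasoning

  advance-id : ∀ L → Complete L → dedup L ≡ L → advance id L ≡ L
  advance-id L c dedup-L = begin
    dedup (map id L ++ allFin k)                  ≡⟨ cong (λ l → dedup (l ++ allFin k)) (map-id L) ⟩
    dedup (L ++ allFin k)                         ≡⟨ dedup-++ L (allFin k) ⟩
    dedup L ++ filter (_∉? L) (dedup (allFin k))  ≡⟨ cong₂ _++_ dedup-L nothing-new ⟩
    L ++ []                                       ≡⟨ ++-identityʳ L ⟩
    L                                             ∎
    where
    open ≡-Reasoning
    nothing-new : filter (_∉? L) (dedup (allFin k)) ≡ []
    nothing-new = filter-none (_∉? L) {dedup (allFin k)} (All.tabulate λ _ q∉ → q∉ (c _))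

  order-id : ∀ fs → (∀ j q → fs j q ≡ q) → ∀ j → order fs j ≡ initialOrder
  order-id fs id≗ zero    = refl
  order-id fs id≗ (suc j) = begin
    advance (fs j) (order fs j)  ≡⟨ advance-cong (id≗ j) (order fs j) ⟩
    advance id (order fs j)      ≡⟨ advance-id (order fs j) (order-complete fs j) (order-dedup fs j) ⟩
    order fs j                   ≡⟨ order-id fs id≗ j ⟩
    initialOrder                 ∎
    where open ≡-Reasoning

  ∈-map-complete : ∀ (g : Step) {L L' q} → Complete L' → q ∈ map g L → q ∈ map g L'
  ∈-map-complete g c' q∈ with ∈-map⁻ g q∈
  ... | p , _ , refl = ∈-map⁺ g (c' p)

  reorder-dedup : ∀ g {L L'} Z → Complete L → Complete L' →
                  dedup (map g L' ++ Z) ≡ reorder g L' (dedup (map g L ++ Z))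
  reorder-dedup g {L} {L'} Z c c' = begin
    dedup (map g L' ++ Z)                                     ≡⟨ dedup-++ (map g L') Z ⟩
    dedup (map g L') ++ filter (_∉? map g L') (dedup Z)       ≡⟨ cong (dedup (map g L') ++_) forget-old ⟨
    reorder g L' (dedup (map g L ++ Z))                       ∎
    where
    open ≡-Reasoning
    forget-old : filter (_∉? map g L') (dedup (map g L ++ Z)) ≡ filter (_∉? map g L') (dedup Z)
    forget-old = begin
      filter (_∉? map g L') (dedup (map g L ++ Z))
        ≡⟨ cong (filter (_∉? map g L')) (dedup-++ (map g L) Z) ⟩
      filter (_∉? map g L') (dedup (map g L) ++ filter (_∉? map g L) (dedup Z))
        ≡⟨ filter-++ (_∉? map g L') (dedup (map g L)) _ ⟩
      filter (_∉? map g L') (dedup (map g L)) ++ filter (_∉? map g L') (filter (_∉? map g L) (dedup Z))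
        ≡⟨ cong₂ _++_ old-image-dropped
                      (filter-filter (_∉? map g L') (_∉? map g L) (_∉? map g L') ∉-both (λ q∉ _ → q∉) (dedup Z)) ⟩
      filter (_∉? map g L') (dedup Z) ∎
      where
      image-complete : ∀ {q} → q ∈ map g L → q ∈ map g L'
      image-complete = ∈-map-complete g c'
      ∉-both : ∀ {q} → q ∉ map g L' → (q ∉ map g L') × (q ∉ map g L)
      ∉-both q∉ = q∉ , q∉ ∘ image-complete
      old-image-dropped : filter (_∉? map g L') (dedup (map g L)) ≡ []
      old-image-dropped = filter-none (_∉? map g L')
        (All.tabulate λ q∈ q∉ → q∉ (image-complete (∈-deduplicate⁻ _≟_ (map g L) q∈)))

  order-update : ∀ {fs fs'} y → (∀ i → y < i → ∀ q → fs i q ≡ fs' i q) → ∀ m →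
                 order fs' (suc (y + m))
                   ≡ reorder (compose fs' (suc y) m) (order fs' (suc y)) (order fs (suc (y + m)))
  order-update {fs} {fs'} y agree m = begin
    order fs' (suc y + m)
      ≡⟨ order-+ fs' (suc y) m ⟩
    dedup (map g L' ++ restarts fs' (suc y) m)
      ≡⟨ cong (λ Z → dedup (map g L' ++ Z)) (restarts-cong (suc y) agree m) ⟨
    dedup (map g L' ++ Z)
      ≡⟨ reorder-dedup g Z (order-complete fs (suc y)) (order-complete fs' (suc y)) ⟩
    reorder g L' (dedup (map g (order fs (suc y)) ++ Z))
      ≡⟨ cong (λ l → reorder g L' (dedup (l ++ Z))) (map-cong (compose-cong (suc y) agree m) (order fs (suc y))) ⟨
    reorder g L' (dedup (map (compose fs (suc y) m) (order fs (suc y)) ++ Z))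
      ≡⟨ cong (reorder g L') (order-+ fs (suc y) m) ⟨
    reorder g L' (order fs (suc y + m)) ∎
    where
    open ≡-Reasoning
    g = compose fs' (suc y) m
    Z = restarts fs (suc y) m
    L' = order fs' (suc y)

module Paths (k : ℕ) (start : Fin k) where

  open import Data.Bool.Base using (Bool; true; false; T; not; _∧_; if_then_else_)
  open import Data.Bool.Properties using (∧-inverseˡ; ∧-identityʳ; T-∧)
  open import Data.Fin.Base using (Fin; zero; suc; toℕ)
  open import Data.Fin.Properties using (_≟_)
  open import Data.List.Base using (List; length)
  open import Data.Nat.Base using (ℕ; zero; suc; _+_; _∸_; _≤_; _<_; _≤ᵇ_; _<ᵇ_; z≤n; s≤s)
  open import Data.Nat.Properties hiding (_≟_)
  open import Data.Product using (∃; _×_; _,_; proj₁; proj₂)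
  open import Function using (_∘_; _⇔_; mk⇔; Equivalence)
  open import Relation.Binary.PropositionalEquality
  open import Relation.Nullary using (¬_; contradiction)
  open import Relation.Nullary.Reflects using (ofʸ; ofⁿ)
  open import Relation.Nullary.Decidable using (does)
  open Defs using (allFin)
  open Lists
  open Booleans
  open Equivalence using (to; from)

  open Orders k start
  open WithDecidableEquality (_≟_ {k})

  -- Positions are abstract so that the checks below can be computed both inside
  -- formulas, on variables, and in the semantics, on natural numbers.
  record Frame : Set₁ where
    field
      Pos    : Set
      _≤ᵖ_   : Pos → Pos → Bool
      before : Pos → List (Fin k)
      after  : Pos → List (Fin k)
      letter : Pos → Step

  -- z p t is the position after y at which the rank in the old orders of the
  -- image of p drops to at most t; ranks are counted against these thresholds.
  module PathCheck (F : Frame) (y : Frame.Pos F) (z : Fin k → Fin k → Frame.Pos F) where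

    open Frame F

    _<ᵖ_ : Pos → Pos → Bool
    a <ᵖ b = not (b ≤ᵖ a)

    rank₀ : Fin k → ℕ
    rank₀ p = indexOf p (after y)

    rankWith : Fin k → (Pos → Bool) → ℕ
    rankWith p passed = count λ t → (toℕ t <ᵇ rank₀ p) ∧ not ((y <ᵖ z p t) ∧ passed (z p t))

    rankAt rankBefore : Fin k → Pos → ℕ
    rankAt     p v = rankWith p (_≤ᵖ v)
    rankBefore p u = rankWith p (_<ᵖ u)

    image : Pos → Step
    image x p = nth start (after x) (rankAt p x)

    stepOK : Pos → Pos → Fin k → Bool
    stepOK x u p = (y <ᵖ u) ∧ (u ≤ᵖ x)
                   →ᵇ does (letter u (nth start (before u) (rankBefore p u)) ≟ image u p)

    pathsOK : Pos → Pos → Bool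
    pathsOK x u = allFin (stepOK x u)

    newOrder : Pos → List (Fin k)
    newOrder x = reorder (image x) (advance (letter y) (before y)) (after x)

  record FrameMap (F G : Frame) : Set where
    open Frame
    field
      pos        : Pos F → Pos G
      ≤-pos      : ∀ a b → _≤ᵖ_ F a b ≡ _≤ᵖ_ G (pos a) (pos b)
      before-pos : ∀ a → before F a ≡ before G (pos a)
      after-pos  : ∀ a → after F a ≡ after G (pos a)
      letter-pos : ∀ a q → letter F a q ≡ letter G (pos a) q

  idFrameMap : ∀ {F} → FrameMap F F
  idFrameMap = record
    { pos        = λ a → a
    ; ≤-pos      = λ _ _ → refl
    ; before-pos = λ _ → refl
    ; after-pos  = λ _ → refl
    ; letter-pos = λ _ _ → refl
    }

  module PathCheckMap {F G} (φ : FrameMap F G)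
    (y : Frame.Pos F) (y' : Frame.Pos G) (y-pos : FrameMap.pos φ y ≡ y')
    (z : Fin k → Fin k → Frame.Pos F) (z' : Fin k → Fin k → Frame.Pos G)
    (z-pos : ∀ p t → FrameMap.pos φ (z p t) ≡ z' p t) where

    open FrameMap φ
    module PF = PathCheck F y z
    module PG = PathCheck G y' z'

    <-pos : ∀ a b → a PF.<ᵖ b ≡ pos a PG.<ᵖ pos b
    <-pos a b = cong not (≤-pos b a)

    rank₀-pos : ∀ p → PF.rank₀ p ≡ PG.rank₀ p
    rank₀-pos p = cong (indexOf p) (trans (after-pos y) (cong (Frame.after G) y-pos))

    rankWith-pos : ∀ p {r r'} → (∀ t → r (z p t) ≡ r' (z' p t)) → PF.rankWith p r ≡ PG.rankWith p r'
    rankWith-pos p eq = count-cong λ t → cong₂ (λ r c → (toℕ t <ᵇ r) ∧ not c) (rank₀-pos p)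
      (cong₂ _∧_ (trans (<-pos y (z p t)) (cong₂ PG._<ᵖ_ y-pos (z-pos p t))) (eq t))

    rankAt-pos : ∀ p v → PF.rankAt p v ≡ PG.rankAt p (pos v)
    rankAt-pos p v = rankWith-pos p {λ a → Frame._≤ᵖ_ F a v} {λ a → Frame._≤ᵖ_ G a (pos v)} λ t →
      trans (≤-pos (z p t) v) (cong (λ a → Frame._≤ᵖ_ G a (pos v)) (z-pos p t))

    rankBefore-pos : ∀ p u → PF.rankBefore p u ≡ PG.rankBefore p (pos u)
    rankBefore-pos p u = rankWith-pos p {PF._<ᵖ u} {PG._<ᵖ pos u} λ t →
      trans (<-pos (z p t) u) (cong (PG._<ᵖ pos u) (z-pos p t))

    image-pos : ∀ x p → PF.image x p ≡ PG.image (pos x) p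
    image-pos x p = cong₂ (nth start) (after-pos x) (rankAt-pos p x)

    stepOK-pos : ∀ x u p → PF.stepOK x u p ≡ PG.stepOK (pos x) (pos u) p
    stepOK-pos x u p = cong₂ _→ᵇ_
      (cong₂ _∧_ (trans (<-pos y u) (cong (PG._<ᵖ pos u) y-pos)) (≤-pos u x))
      (cong₂ (λ a b → does (a ≟ b))
             (trans (cong (Frame.letter F u) (cong₂ (nth start) (before-pos u) (rankBefore-pos p u)))
                    (letter-pos u _))
             (image-pos u p))

    pathsOK-pos : ∀ x u → PF.pathsOK x u ≡ PG.pathsOK (pos x) (pos u)
    pathsOK-pos x u = allFin-cong (stepOK-pos x u)

    newOrder-pos : ∀ x → PF.newOrder x ≡ PG.newOrder (pos x)
    newOrder-pos x = trans (reorder-cong (image-pos x) (advance (Frame.letter F y) (Frame.before F y)) (Frame.after F x))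
      (cong₂ (reorder (PG.image (pos x))) (trans (advance-cong (letter-pos y) _) advance-pos) (after-pos x))
      where
      advance-pos : advance (Frame.letter G (pos y)) (Frame.before F y) ≡ advance (Frame.letter G y') (Frame.before G y')
      advance-pos = cong₂ (λ a → advance (Frame.letter G a)) y-pos (trans (before-pos y) (cong (Frame.before G) y-pos))

  orderFrame : (ℕ → List (Fin k)) → (ℕ → Step) → Frame
  orderFrame O fs = record { Pos = ℕ ; _≤ᵖ_ = _≤ᵇ_ ; before = O ; after = O ∘ suc ; letter = fs }

  not-suc≤ᵇ : ∀ v z → not (suc v ≤ᵇ z) ≡ (z ≤ᵇ v)
  not-suc≤ᵇ v z = bool-ext (λ t → from (T-≤ᵇ {z} {v}) (≤-pred (to (T-not-≤ᵇ {z} {suc v}) t)))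
                           (λ t → from (T-not-≤ᵇ {z} {suc v}) (s≤s (to (T-≤ᵇ {z} {v}) t)))

  module OrderPaths (O : ℕ → List (Fin k)) (fs : ℕ → Step) (y : ℕ) (z : Fin k → Fin k → ℕ) where

    open PathCheck (orderFrame O fs) y z public

    rankAt-y : Complete (O (suc y)) → length (O (suc y)) ≡ k → ∀ p → rankAt p y ≡ rank₀ p
    rankAt-y c len p = trans
      (count-cong λ t → trans (cong (λ b → (toℕ t <ᵇ rank₀ p) ∧ not b) (∧-inverseˡ (z p t ≤ᵇ y)))
                              (∧-identityʳ _))
      (count-<ᵇ (rank₀ p) (<⇒≤ (subst (rank₀ p <_) len (indexOf<length (O (suc y)) (c p)))))

    rankBefore-suc : ∀ p v → rankBefore p (suc v) ≡ rankAt p v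
    rankBefore-suc p v = count-cong λ t →
      cong (λ b → (toℕ t <ᵇ rank₀ p) ∧ not (not (z p t ≤ᵇ y) ∧ b)) (not-suc≤ᵇ v (z p t))

    stepOK⇒ : ∀ {x u p} → T (stepOK x u p) → y < u → u ≤ x →
              fs u (nth start (O u) (rankBefore p u)) ≡ image u p
    stepOK⇒ ok y<u u≤x =
      to (T-does (_ ≟ _)) (to T-→ᵇ ok (from T-∧ (from T-not-≤ᵇ y<u , ≤⇒≤ᵇ u≤x)))

    stepOK-beyond : ∀ {x u} p → x < u → T (stepOK x u p)
    stepOK-beyond {x} {u} p x<u = from T-→ᵇ λ inRange →
      contradiction (≤ᵇ⇒≤ u x (proj₂ (to (T-∧ {not (u ≤ᵇ y)}) inRange))) (<⇒≱ x<u)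

    image-sound : Complete (O (suc y)) → length (O (suc y)) ≡ k → ∀ x →
                  (∀ u p → T (stepOK x u p)) →
                  ∀ p m → y + m ≤ x → image (y + m) p ≡ compose fs (suc y) m p
    image-sound c len x ok p zero _ rewrite +-identityʳ y =
      trans (cong (nth start (O (suc y))) (rankAt-y c len p)) (nth-indexOf start (O (suc y)) (c p))
    image-sound c len x ok p (suc m) y+m<x rewrite +-suc y m = begin
      image (suc (y + m)) p
        ≡⟨ stepOK⇒ (ok _ p) (s≤s (m≤m+n y m)) y+m<x ⟨
      fs (suc (y + m)) (nth start (O (suc (y + m))) (rankBefore p (suc (y + m))))
        ≡⟨ cong (fs (suc (y + m)) ∘ nth start (O (suc (y + m)))) (rankBefore-suc p (y + m)) ⟩
      fs (suc (y + m)) (image (y + m) p)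
        ≡⟨ cong (fs (suc (y + m))) (image-sound c len x ok p m (<⇒≤ y+m<x)) ⟩
      compose fs (suc y) (suc m) p ∎
      where open ≡-Reasoning

  module Completeness (fso fs : ℕ → Step) (y x : ℕ) (y≤x : y ≤ x)
                      (agree : ∀ i → y < i → ∀ q → fso i q ≡ fs i q) where

    M : ℕ
    M = x ∸ y

    y+M≡x : y + M ≡ x
    y+M≡x = m+[n∸m]≡n y≤x

    trueRank : Fin k → ℕ → ℕ
    trueRank p m = indexOf (compose fs (suc y) m p) (order fso (suc (y + m)))

    trueRank-suc : ∀ p m → trueRank p (suc m) ≤ trueRank p m
    trueRank-suc p m rewrite +-suc y m = begin
      indexOf (fs u (compose fs (suc y) m p)) (advance (fso u) (order fso u))
        ≡⟨ cong (indexOf _) (advance-cong (agree u (s≤s (m≤m+n y m))) (order fso u)) ⟩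
      indexOf (fs u (compose fs (suc y) m p)) (advance (fs u) (order fso u))
        ≤⟨ indexOf-advance (fs u) _ _ (order-complete fso u _) ⟩
      trueRank p m ∎
      where
      open ≤-Reasoning
      u = suc (y + m)

    trueRank<k : ∀ p m → trueRank p m < k
    trueRank<k p m = subst (trueRank p m <_) (order-length fso (suc (y + m)))
                           (indexOf<length (order fso (suc (y + m))) (order-complete fso (suc (y + m)) _))

    -- A rank that stays above t up to x gets the threshold y, which never counts as passed.
    encode : ℕ → ℕ
    encode ℓ = if ℓ <ᵇ M then y + suc ℓ else y

    encode≤x : ∀ ℓ → encode ℓ ≤ x
    encode≤x ℓ with ℓ <ᵇ M | <ᵇ-reflects-< ℓ M
    ... | true  | ofʸ ℓ<M = subst (y + suc ℓ ≤_) y+M≡x (+-monoʳ-≤ y ℓ<M)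
    ... | false | ofⁿ _   = y≤x

    encode-passed : ∀ ℓ {m} → m ≤ M → T (not (encode ℓ ≤ᵇ y) ∧ (encode ℓ ≤ᵇ y + m)) ⇔ ℓ < m
    encode-passed ℓ {m} m≤M with ℓ <ᵇ M | <ᵇ-reflects-< ℓ M
    ... | true  | ofʸ ℓ<M = mk⇔
      (λ t → +-cancelˡ-≤ y (suc ℓ) m (≤ᵇ⇒≤ _ _ (proj₂ (to T-∧ t))))
      (λ ℓ<m → from T-∧ (from T-not-≤ᵇ (m<m+n y (s≤s z≤n)) , ≤⇒≤ᵇ (+-monoʳ-≤ y ℓ<m)))
    ... | false | ofⁿ ℓ≮M = mk⇔
      (λ t → contradiction (to (T-not-≤ᵇ {y} {y}) (proj₁ (to T-∧ t))) (<-irrefl refl))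
                               (λ ℓ<m → contradiction (<-≤-trans ℓ<m m≤M) ℓ≮M)

    thresholds : Fin k → Fin k → ℕ
    thresholds p t = encode (lastTrue (λ m → toℕ t <ᵇ trueRank p m) M)

    open OrderPaths (order fso) fs y thresholds

    rank₀≡trueRank₀ : ∀ p → rank₀ p ≡ trueRank p 0
    rank₀≡trueRank₀ p = cong (λ v → indexOf p (order fso (suc v))) (sym (+-identityʳ y))

    rankAt-true : ∀ p m → m ≤ M → rankAt p (y + m) ≡ trueRank p m
    rankAt-true p m m≤M = trans (count-cong above⇔) (count-<ᵇ (trueRank p m) (<⇒≤ (trueRank<k p m)))
      where
      passed : Fin k → Bool
      passed t = not (thresholds p t ≤ᵇ y) ∧ (thresholds p t ≤ᵇ y + m)
      above⇔ : ∀ t → (toℕ t <ᵇ rank₀ p) ∧ not (passed t) ≡ (toℕ t <ᵇ trueRank p m)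
      above⇔ t = bool-ext counted⇒above above⇒counted
        where
        P : ℕ → Bool
        P j = toℕ t <ᵇ trueRank p j
        down : ∀ j → T (P (suc j)) → T (P j)
        down j t<r = <⇒<ᵇ (<-≤-trans (<ᵇ⇒< _ _ t<r) (trueRank-suc p j))
        spec : T (P 0) → T (P m) ⇔ m ≤ lastTrue P M
        spec p0 = lastTrue-spec P down p0 M m≤M
        below-rank₀ : (toℕ t <ᵇ rank₀ p) ≡ P 0
        below-rank₀ = cong (toℕ t <ᵇ_) (rank₀≡trueRank₀ p)
        counted⇒above : T ((toℕ t <ᵇ rank₀ p) ∧ not (passed t)) → T (P m)
        counted⇒above h with to T-∧ h
        ... | t<r₀ , ¬passed = from (spec (subst T below-rank₀ t<r₀))
                                 (≮⇒≥ (to T-not ¬passed ∘ from (encode-passed _ m≤M)))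
        above⇒counted : T (P m) → T ((toℕ t <ᵇ rank₀ p) ∧ not (passed t))
        above⇒counted t<rₘ = from T-∧
          ( subst T (sym below-rank₀) p0
          , from T-not (λ passed → <⇒≱ (to (encode-passed _ m≤M) passed) (to (spec p0) t<rₘ)))
          where p0 = downward P down t<rₘ z≤n

    image-true : ∀ p m → m ≤ M → image (y + m) p ≡ compose fs (suc y) m p
    image-true p m m≤M = trans (cong (nth start O) (rankAt-true p m m≤M)) (nth-indexOf start O (order-complete fso (suc (y + m)) _))
      where O = order fso (suc (y + m))

    stepOK-at : ∀ m → suc m ≤ M → ∀ p →
                fs (suc (y + m)) (nth start (order fso (suc (y + m))) (rankBefore p (suc (y + m)))) ≡ image (suc (y + m)) p
    stepOK-at m m<M p = begin
      fs u (nth start (order fso u) (rankBefore p u))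
        ≡⟨ cong (fs u ∘ nth start (order fso u)) (rankBefore-suc p (y + m)) ⟩
      fs u (image (y + m) p)
        ≡⟨ cong (fs u) (image-true p m (<⇒≤ m<M)) ⟩
      compose fs (suc y) (suc m) p
        ≡⟨ image-true p (suc m) m<M ⟨
      image (y + suc m) p
        ≡⟨ cong (λ v → image v p) (+-suc y m) ⟩
      image u p ∎
      where
      open ≡-Reasoning
      u = suc (y + m)

    stepOK-true : ∀ u p → T (stepOK x u p)
    stepOK-true u p = from T-→ᵇ λ inRange →
      let y<u = to T-not-≤ᵇ (proj₁ (to T-∧ inRange))
          u≤x = ≤ᵇ⇒≤ u x (proj₂ (to (T-∧ {not (u ≤ᵇ y)}) inRange))
          u≡ : suc (y + (u ∸ suc y)) ≡ u
          u≡ = m+[n∸m]≡n y<u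
          m<M : suc (u ∸ suc y) ≤ M
          m<M = +-cancelˡ-≤ y _ _ (subst₂ _≤_ (sym (trans (+-suc y _) u≡)) (sym y+M≡x) u≤x)
      in from (T-does (_ ≟ _))
           (subst (λ v → fs v (nth start (order fso v) (rankBefore p v)) ≡ image v p) u≡ (stepOK-at _ m<M p))

  module Update (fso fs : ℕ → Step) (y : ℕ) (agree : ∀ i → ¬ i ≡ y → ∀ q → fso i q ≡ fs i q) where

    agree-above : ∀ i → y < i → ∀ q → fso i q ≡ fs i q
    agree-above i y<i = agree i (>⇒≢ y<i)

    order-below : ∀ j → j ≤ y → order fso j ≡ order fs j
    order-below j j≤y = order-cong j λ i i<j → agree i (<⇒≢ (<-≤-trans i<j j≤y))

    module _ (z : Fin k → Fin k → ℕ) where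
      open OrderPaths (order fso) fs y z

      newOrder-sound : ∀ x → y ≤ x → (∀ u p → T (stepOK x u p)) → newOrder x ≡ order fs (suc x)
      newOrder-sound x y≤x ok = begin
        reorder (image x) (advance (fs y) (order fso y)) (order fso (suc x))
          ≡⟨ reorder-cong image≗ (advance (fs y) (order fso y)) (order fso (suc x)) ⟩
        reorder g (advance (fs y) (order fso y)) (order fso (suc x))
          ≡⟨ cong (λ L → reorder g (advance (fs y) L) (order fso (suc x))) (order-below y ≤-refl) ⟩
        reorder g (order fs (suc y)) (order fso (suc x))
          ≡⟨ subst (λ v → order fs (suc v) ≡ reorder g (order fs (suc y)) (order fso (suc v))) y+M≡x
                   (order-update y agree-above M) ⟨
        order fs (suc x) ∎
        where
        open ≡-Reasoning
        M = x ∸ y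
        y+M≡x = m+[n∸m]≡n y≤x
        g = compose fs (suc y) M
        image≗ : ∀ p → image x p ≡ g p
        image≗ p = subst (λ v → image v p ≡ g p) y+M≡x
          (image-sound (order-complete fso (suc y)) (order-length fso (suc y)) x ok p M (≤-reflexive y+M≡x))

    certificate : ∀ x → y ≤ x →
                  ∃ λ z → (∀ p t → z p t ≤ x) × (∀ u p → T (OrderPaths.stepOK (order fso) fs y z x u p))
    certificate x y≤x = thresholds , (λ p t → encode≤x _) , stepOK-true
      where open Completeness fso fs y x y≤x agree-above

module Formulas (s k₀ k₁ : ℕ) where

  open import Data.Bool.Base using (Bool; true; false; T; _∧_; _∨_)
  open import Data.Bool.Properties using (∨-identityʳ)
  open import Data.Fin.Base using (Fin; zero; suc; toℕ; _↑ˡ_; _↑ʳ_)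
  open import Data.Fin.Properties using (_≟_; _≤?_)
  open import Data.Maybe.Base using (Maybe; just; nothing)
  import Data.Maybe.Base as Maybe
  open import Data.Nat.Base using (ℕ; zero; suc; _+_; _≤ᵇ_)
  open import Data.Product using (∃; _,_)
  open import Data.Vec.Base using (Vec; []; _∷_; tabulate; lookup)
  open import Data.Vec.Properties using (lookup∘tabulate; tabulate-cong)
  import Data.Vec.Functional as VF
  open import Function using (_∘_; _⇔_; mk⇔; Equivalence)
  open import Relation.Binary.PropositionalEquality
  open import Relation.Nullary.Decidable using (⌊_⌋; yes; no; isYes≗does)
  open Defs
  open Booleans
  open Equivalence using (to; from)

  F : ℕ → Set
  F = Formula s k₀ k₁

  constF : ∀ {v} → Bool → F v
  constF true  = ⊤f
  constF false = ⊥f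

  branch : ∀ {v} → F v → (Bool → F v) → F v
  branch φ K = (φ ∧f K true) ∨f (¬f φ ∧f K false)

  branchAll : ∀ {v} {X : Set} m → (Fin m → (X → F v) → F v) → (Vec X m → F v) → F v
  branchAll zero    ask K = K []
  branchAll (suc m) ask K = ask zero λ x → branchAll m (ask ∘ suc) (K ∘ (x ∷_))

  decodeSymbol : ∀ {m} → Vec Bool m → Maybe (Fin m)
  decodeSymbol []           = nothing
  decodeSymbol (true  ∷ bs) = just zero
  decodeSymbol (false ∷ bs) = Maybe.map suc (decodeSymbol bs)

  branchSymbol : ∀ {v} → Fin v → (Maybe (Fin s) → F v) → F v
  branchSymbol x K = branchAll s (λ σ → branch (W σ x)) (K ∘ decodeSymbol)

  record Atoms (V : ℕ) : Set where
    field
      symbol : Fin V → Maybe (Fin s)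
      auxBit : Fin V → Fin k₁ → Bool
      _≤ᵃ_   : Fin V → Fin V → Bool

  fromTables : ∀ {V} → Vec (Maybe (Fin s)) V → Vec (Vec Bool k₁) V → Vec (Vec Bool V) V → Atoms V
  fromTables syms bits les = record
    { symbol = lookup syms ; auxBit = λ i → lookup (lookup bits i) ; _≤ᵃ_ = λ i → lookup (lookup les i) }

  qfFormula : ∀ {V} → (Atoms V → Bool) → F V
  qfFormula {V} G =
    branchAll V branchSymbol λ syms →
    branchAll V (λ i → branchAll k₁ λ j → branch (U j i)) λ bits →
    branchAll V (λ i → branchAll V λ j → branch (leq i j)) λ les →
    constF (G (fromTables syms bits les))

  QF-constF : ∀ {v} b → QF (constF {v} b)
  QF-constF true  = q⊤
  QF-constF false = q⊥

  QF-branch : ∀ {v} {φ : F v} {K} → QF φ → (∀ b → QF (K b)) → QF (branch φ K)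
  QF-branch qφ qK = q∨ (q∧ qφ (qK true)) (q∧ (q¬ qφ) (qK false))

  QF-branchAll : ∀ {v} {X : Set} m {ask : Fin m → (X → F v) → F v} {K} →
                 (∀ i {K'} → (∀ x → QF (K' x)) → QF (ask i K')) → (∀ xs → QF (K xs)) → QF (branchAll m ask K)
  QF-branchAll zero    qa qK = qK []
  QF-branchAll (suc m) qa qK = qa zero λ x → QF-branchAll m (qa ∘ suc) (qK ∘ (x ∷_))

  QF-qfFormula : ∀ {V} (G : Atoms V → Bool) → QF (qfFormula G)
  QF-qfFormula {V} G =
    QF-branchAll V (λ i qK → QF-branchAll s (λ σ → QF-branch (qW σ i)) (qK ∘ decodeSymbol)) λ _ →
    QF-branchAll V (λ i → QF-branchAll k₁ λ j → QF-branch (qU j i)) λ _ →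
    QF-branchAll V (λ i → QF-branchAll V λ j → QF-branch (qleq i j)) λ _ →
    QF-constF _

  decodeSymbol-isSym : ∀ {m} (c : Maybe (Fin m)) → decodeSymbol (tabulate (isSym c)) ≡ c
  decodeSymbol-isSym {zero}  nothing  = refl
  decodeSymbol-isSym {suc m} nothing  = cong (Maybe.map suc) (decodeSymbol-isSym {m} nothing)
  decodeSymbol-isSym {suc m} (just zero)    = refl
  decodeSymbol-isSym {suc m} (just (suc τ)) =
    cong (Maybe.map suc) (trans (cong decodeSymbol (tabulate-cong isSym-suc)) (decodeSymbol-isSym (just τ)))
    where
    isSym-suc : ∀ σ → isSym (just (suc τ)) (suc σ) ≡ isSym (just τ) σ
    isSym-suc σ with τ ≟ σ
    ... | yes _ = refl
    ... | no _  = refl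

  module _ {n} (w : Word s n) (A : Aux k₀ k₁ n) where

    atomsOf : ∀ {V} → (Fin V → Fin n) → Atoms V
    atomsOf ρ = fromTables (tabulate (w ∘ ρ))
                           (tabulate λ i → tabulate λ j → Aux.un A j (ρ i))
                           (tabulate λ i → tabulate λ j → ⌊ ρ i ≤? ρ j ⌋)

    eval-branch : ∀ {v} (φ : F v) K ρ → eval w A (branch φ K) ρ ≡ eval w A (K (eval w A φ ρ)) ρ
    eval-branch φ K ρ with eval w A φ ρ
    ... | true  = ∨-identityʳ _
    ... | false = refl

    eval-branchAll : ∀ {v} {X : Set} m {ask : Fin m → (X → F v) → F v} ρ (val : Fin m → X) →
                     (∀ i K → eval w A (ask i K) ρ ≡ eval w A (K (val i)) ρ) →
                     ∀ K → eval w A (branchAll m ask K) ρ ≡ eval w A (K (tabulate val)) ρ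
    eval-branchAll zero    ρ val h K = refl
    eval-branchAll (suc m) ρ val h K = trans (h zero _) (eval-branchAll m ρ (val ∘ suc) (h ∘ suc) (K ∘ (val zero ∷_)))

    eval-branchSymbol : ∀ {v} (x : Fin v) K ρ → eval w A (branchSymbol x K) ρ ≡ eval w A (K (w (ρ x))) ρ
    eval-branchSymbol x K ρ =
      trans (eval-branchAll s ρ (isSym (w (ρ x))) (λ σ K' → eval-branch (W σ x) K' ρ) (K ∘ decodeSymbol))
            (cong (λ c → eval w A (K c) ρ) (decodeSymbol-isSym (w (ρ x))))

    eval-constF : ∀ {v} b (ρ : Fin v → Fin n) → eval w A (constF b) ρ ≡ b
    eval-constF true  ρ = refl
    eval-constF false ρ = refl

    eval-qfFormula : ∀ {V} (G : Atoms V → Bool) ρ → eval w A (qfFormula G) ρ ≡ G (atomsOf ρ)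
    eval-qfFormula {V} G ρ =
      trans (eval-branchAll V ρ (w ∘ ρ) (λ i K → eval-branchSymbol i K ρ) _)
     (trans (eval-branchAll V ρ (λ i → tabulate (bit i)) (λ i → eval-branchAll k₁ ρ (bit i) (eval-bit i)) _)
     (trans (eval-branchAll V ρ (λ i → tabulate (≤-row i)) (λ i → eval-branchAll V ρ (≤-row i) (eval-≤ i)) _)
            (eval-constF _ ρ)))
      where
      bit : Fin V → Fin k₁ → Bool
      bit i j = Aux.un A j (ρ i)
      eval-bit : ∀ i j K → eval w A (branch (U j i) K) ρ ≡ eval w A (K (bit i j)) ρ
      eval-bit i j K = eval-branch (U j i) K ρ
      ≤-row : Fin V → Fin V → Bool
      ≤-row i j = ⌊ ρ i ≤? ρ j ⌋
      eval-≤ : ∀ i j K → eval w A (branch (leq i j) K) ρ ≡ eval w A (K (≤-row i j)) ρ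
      eval-≤ i j K = eval-branch (leq i j) K ρ

    module _ {V} (ρ : Fin V → Fin n) where
      open Atoms (atomsOf ρ)

      symbol-atomsOf : ∀ i → symbol i ≡ w (ρ i)
      symbol-atomsOf = lookup∘tabulate (w ∘ ρ)

      auxBit-atomsOf : ∀ i j → auxBit i j ≡ Aux.un A j (ρ i)
      auxBit-atomsOf i j = trans (cong (λ r → lookup r j) (lookup∘tabulate _ i)) (lookup∘tabulate _ j)

      ≤-atomsOf : ∀ i j → (i ≤ᵃ j) ≡ (toℕ (ρ i) ≤ᵇ toℕ (ρ j))
      ≤-atomsOf i j = trans (cong (λ r → lookup r j) (lookup∘tabulate _ i))
                            (trans (lookup∘tabulate _ j) (isYes≗does (ρ i ≤? ρ j)))

  exists : ∀ {v} e → F (e + v) → F v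
  exists zero    φ = φ
  exists (suc e) φ = exists e (∃f φ)

  Σ₂-exists : ∀ {v} e {φ : F (e + v)} → Σ₂ φ → Σ₂ (exists e φ)
  Σ₂-exists zero    σφ = σφ
  Σ₂-exists (suc e) σφ = Σ₂-exists e (ex σφ)

  ∃∀ : ∀ {v} e → (Atoms (suc (e + v)) → Bool) → F v
  ∃∀ e G = exists e (∀f (qfFormula G))

  Σ₂-∃∀ : ∀ {v} e (G : Atoms (suc (e + v)) → Bool) → Σ₂ (∃∀ e G)
  Σ₂-∃∀ e G = Σ₂-exists e (pi (all (qf (QF-qfFormula G))))

  infixr 5 _++ᵃ_
  _++ᵃ_ : ∀ {n e v} → Vec (Fin n) e → (Fin v → Fin n) → Fin (e + v) → Fin n
  []       ++ᵃ ρ = ρ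
  (a ∷ xs) ++ᵃ ρ = a VF.∷ (xs ++ᵃ ρ)

  ++ᵃ-↑ˡ : ∀ {n e v} (xs : Vec (Fin n) e) (ρ : Fin v → Fin n) c → (xs ++ᵃ ρ) (c ↑ˡ v) ≡ lookup xs c
  ++ᵃ-↑ˡ (a ∷ xs) ρ zero    = refl
  ++ᵃ-↑ˡ (a ∷ xs) ρ (suc c) = ++ᵃ-↑ˡ xs ρ c

  ++ᵃ-↑ʳ : ∀ {n e v} (xs : Vec (Fin n) e) (ρ : Fin v → Fin n) j → (xs ++ᵃ ρ) (e ↑ʳ j) ≡ ρ j
  ++ᵃ-↑ʳ []       ρ j = refl
  ++ᵃ-↑ʳ (a ∷ xs) ρ j = ++ᵃ-↑ʳ xs ρ j

  module _ {n} (w : Word s n) (A : Aux k₀ k₁ n) where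

    T-eval-exists : ∀ {v} e (φ : F (e + v)) ρ →
                    T (eval w A (exists e φ) ρ) ⇔ ∃ λ (xs : Vec (Fin n) e) → T (eval w A φ (xs ++ᵃ ρ))
    T-eval-exists zero    φ ρ = mk⇔ ([] ,_) λ { ([] , t) → t }
    T-eval-exists (suc e) φ ρ = mk⇔
      (λ t → let xs , t' = to (T-eval-exists e (∃f φ) ρ) t
                 a , t'' = to (T-anyFin _) t'
             in a ∷ xs , t'')
      (λ { (a ∷ xs , t) → from (T-eval-exists e (∃f φ) ρ) (xs , from (T-anyFin _) (a , t)) })

    T-eval-∃∀ : ∀ {v} e (G : Atoms (suc (e + v)) → Bool) ρ →
                T (eval w A (∃∀ e G) ρ) ⇔
                ∃ λ (xs : Vec (Fin n) e) → ∀ u → T (G (atomsOf w A (u VF.∷ (xs ++ᵃ ρ))))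
    T-eval-∃∀ e G ρ = mk⇔
      (λ t → let xs , t' = to (T-eval-exists e _ ρ) t in
             xs , λ u → subst T (eval-qfFormula w A G _) (to (T-allFin _) t' u))
      (λ (xs , h) → from (T-eval-exists e _ ρ)
             (xs , from (T-allFin _) λ u → subst T (sym (eval-qfFormula w A G _)) (h u)))

module Construction (s : ℕ) (D : Defs.DFA s) where

  open import Data.Bool.Base using (Bool; true; false; T; not; _∧_; if_then_else_)
  open import Data.Bool.Properties using (T-∧)
  open import Data.Fin.Base using (Fin; zero; suc; toℕ; fromℕ<; _↑ˡ_; _↑ʳ_; combine; remQuot)
  open import Data.Fin.Properties using (_≟_; toℕ-fromℕ<; fromℕ<-toℕ; remQuot-combine; toℕ<n)
  open import Data.List.Base using (List; []; _∷_; foldl; catMaybes; tabulate; length)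
  open import Data.List.Properties using (tabulate-cong)
  open import Data.Maybe.Base using (Maybe; just; nothing; fromMaybe)
  import Data.Maybe.Base as Maybe
  open import Data.Nat.Base using (ℕ; zero; suc; _+_; _∸_; _*_; _≤_; _<_; _≤ᵇ_; z≤n)
  open import Data.Nat.Properties hiding (_≟_)
  open import Data.Product using (Σ; ∃; _×_; _,_; proj₁; proj₂)
  import Data.Product as Product
  open import Data.Vec.Base as Vec using (Vec; _∷_)
  open import Data.Vec.Properties using (lookup∘tabulate)
  import Data.Vec.Functional as VF
  open import Function using (_∘_; _⇔_; mk⇔; Equivalence)
  open import Relation.Binary.PropositionalEquality
  open import Relation.Nullary using (¬_; Dec; yes; no; contradiction)
  open import Relation.Nullary.Decidable using (does)
  open Defs
  open Lists
  open Booleans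
  open Equivalence using (to; from)

  k : ℕ
  k = DFA.states D

  open DFA D using (start; δ; final)
  open Orders k start
  open Paths k start
  open WithDecidableEquality (_≟_ {k})

  letterOf : Maybe (Fin s) → Step
  letterOf nothing  q = q
  letterOf (just σ) q = δ q σ

  at : ∀ {n} → Word s n → ℕ → Maybe (Fin s)
  at {n} w j with j <? n
  ... | yes j<n = w (fromℕ< j<n)
  ... | no _    = nothing

  letters : ∀ {n} → Word s n → ℕ → Step
  letters w = letterOf ∘ at w

  orders : ∀ {n} → Word s n → ℕ → List (Fin k)
  orders w = order (letters w)

  at-toℕ : ∀ {n} (w : Word s n) i → at w (toℕ i) ≡ w i
  at-toℕ {n} w i with toℕ i <? n
  ... | yes i<n = cong w (fromℕ<-toℕ i i<n)
  ... | no i≮n  = contradiction (toℕ<n i) i≮n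

  at-setWord : ∀ {n} (w : Word s n) i σ j → ¬ j ≡ toℕ i → at (setWord w (i , σ)) j ≡ at w j
  at-setWord {n} w i σ j j≢i with j <? n
  ... | no _    = refl
  ... | yes j<n with fromℕ< j<n ≟ i
  ...   | yes refl = contradiction (sym (toℕ-fromℕ< j<n)) j≢i
  ...   | no _     = refl

  at-empty : ∀ {n} j → at (emptyWord {s} {n}) j ≡ nothing
  at-empty {n} j with j <? n
  ... | yes _ = refl
  ... | no _  = refl

  reached-compose : ∀ fs j → reached fs j ≡ compose fs 0 j start
  reached-compose fs zero    = refl
  reached-compose fs (suc j) = cong (fs j) (reached-compose fs j)

  foldl-letters : ∀ m (f : ℕ → Maybe (Fin s)) q →
                  foldl δ q (catMaybes (tabulate {n = m} (f ∘ toℕ))) ≡ compose (letterOf ∘ f) 0 m q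
  foldl-letters zero    f q = refl
  foldl-letters (suc m) f q = begin
    foldl δ q (catMaybes (f 0 ∷ rest))                          ≡⟨ foldl-head (f 0) rest ⟩
    foldl δ (letterOf (f 0) q) (catMaybes rest)                 ≡⟨ foldl-letters m (λ j → f (suc j)) _ ⟩
    compose (λ j → letterOf (f (suc j))) 0 m (letterOf (f 0) q) ≡⟨ compose-shift (letterOf ∘ f) 0 m _ ⟩
    compose (letterOf ∘ f) 1 m (letterOf (f 0) q)               ≡⟨ compose-suc (letterOf ∘ f) 0 m q ⟨
    compose (letterOf ∘ f) 0 (suc m) q                          ∎
    where
    open ≡-Reasoning
    rest = tabulate {n = m} (λ i → f (suc (toℕ i)))
    foldl-head : ∀ c cs → foldl δ q (catMaybes (c ∷ cs)) ≡ foldl δ (letterOf c q) (catMaybes cs)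
    foldl-head nothing  cs = refl
    foldl-head (just σ) cs = refl

  reached-accepts : ∀ {n} (w : Word s n) → final (reached (letters w) n) ≡ accepts D (wordOf w)
  reached-accepts {n} w = cong final (begin
    reached (letters w) n
      ≡⟨ reached-compose (letters w) n ⟩
    compose (letters w) 0 n start
      ≡⟨ foldl-letters n (at w) start ⟨
    foldl δ start (catMaybes (tabulate {n = n} (at w ∘ toℕ)))
      ≡⟨ cong (λ l → foldl δ start (catMaybes l)) (tabulate-cong (at-toℕ w)) ⟩
    foldl δ start (catMaybes (tabulate w)) ∎)
    where open ≡-Reasoning

  largestBelow : ∀ {n X} → 0 < X → X ≤ n → ∀ (x : Fin n) →
                 (toℕ x < X × (∀ (u : Fin n) → toℕ u < X → toℕ u ≤ toℕ x)) ⇔ toℕ x ≡ X ∸ 1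
  largestBelow {n} {X} 0<X X≤n x = mk⇔
    (λ (x<X , below≤x) → ≤-antisym (<⇒≤pred x<X) (subst (_≤ toℕ x) (toℕ-fromℕ< X-1<n) (below≤x X-1 X-1<X′)))
    (λ x≡ → subst (_< X) (sym x≡) X-1<X , λ u u<X → subst (toℕ u ≤_) (sym x≡) (<⇒≤pred u<X))
    where
    X-1<X : X ∸ 1 < X
    X-1<X = ≤-reflexive (m+[n∸m]≡n 0<X)
    X-1<n : X ∸ 1 < n
    X-1<n = <-≤-trans X-1<X X≤n
    X-1 : Fin n
    X-1 = fromℕ< X-1<n
    X-1<X′ : toℕ X-1 < X
    X-1<X′ = subst (_< X) (sym (toℕ-fromℕ< X-1<n)) X-1<X

  data Side : Set where
    after before : Side

  sideOrder : ∀ {n} → Word s n → Side → Fin n → List (Fin k)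
  sideOrder w after  a = orders w (suc (toℕ a))
  sideOrder w before a = orders w (toℕ a)

  isAt : Fin k → Fin k → List (Fin k) → Bool
  isAt r q L = does (nth start L (toℕ r) ≟ q)

  k₁ : ℕ
  k₁ = 2 * (k * k)

  sideCode : Side → Fin 2
  sideCode after  = zero
  sideCode before = suc zero

  auxIndex : Side → Fin k → Fin k → Fin k₁
  auxIndex side r q = combine (sideCode side) (combine r q)

  sideOf : Fin 2 → Side
  sideOf zero    = after
  sideOf (suc _) = before

  decodeIndex : Fin k₁ → Side × Fin k × Fin k
  decodeIndex = Product.map sideOf (remQuot k) ∘ remQuot (k * k)

  decodeIndex-auxIndex : ∀ side r q → decodeIndex (auxIndex side r q) ≡ (side , r , q)
  decodeIndex-auxIndex side r q = trans
    (cong (Product.map sideOf (remQuot k)) (remQuot-combine (sideCode side) (combine r q)))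
    (cong₂ _,_ (sideOf-sideCode side) (remQuot-combine r q))
    where
    sideOf-sideCode : ∀ side → sideOf (sideCode side) ≡ side
    sideOf-sideCode after  = refl
    sideOf-sideCode before = refl

  accepting : ∀ {n} → Word s n → Bool
  accepting {n} w = final (nth start (orders w n) 0)

  record Invariant {n} (w : Word s n) (A : Aux 1 k₁ n) : Set where
    field
      aux-correct : ∀ side r q a → Aux.un A (auxIndex side r q) a ≡ isAt r q (sideOrder w side a)
      acc-correct : Aux.nul A zero ≡ accepting w

  firstTrue : ∀ {m} → (Fin m → Bool) → Maybe (Fin m)
  firstTrue {zero}  h = nothing
  firstTrue {suc m} h = if h zero then just zero else Maybe.map suc (firstTrue (h ∘ suc))

  firstTrue-≟ : ∀ {m} {h : Fin m → Bool} c → (∀ q → h q ≡ does (c ≟ q)) → firstTrue h ≡ just c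
  firstTrue-≟ {suc m} zero    h≡ rewrite h≡ zero = refl
  firstTrue-≟ {suc m} (suc c) h≡ rewrite h≡ zero = cong (Maybe.map suc) (firstTrue-≟ c (h≡ ∘ suc))

  decodeOrder : (Fin k → Fin k → Bool) → List (Fin k)
  decodeOrder bits = tabulate λ r → fromMaybe start (firstTrue (bits r))

  decodeOrder-isAt : ∀ {bits} L → length L ≡ k → (∀ r q → bits r q ≡ isAt r q L) → decodeOrder bits ≡ L
  decodeOrder-isAt L len bits≡ = trans
    (tabulate-cong λ r → cong (fromMaybe start) (firstTrue-≟ (nth start L (toℕ r)) (bits≡ r)))
    (tabulate-nth start L len)

  open Formulas s 1 k₁

  decodeSide : ∀ {V} → Atoms V → Side → Fin V → List (Fin k)
  decodeSide E side a = decodeOrder λ r q → Atoms.auxBit E a (auxIndex side r q)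

  atomFrame : ∀ {V} → Atoms V → Frame
  atomFrame {V} E = record
    { Pos    = Fin V
    ; _≤ᵖ_   = Atoms._≤ᵃ_ E
    ; before = decodeSide E before
    ; after  = decodeSide E after
    ; letter = letterOf ∘ Atoms.symbol E
    }

  atomFrameMap : ∀ {n V} {w : Word s n} {A} → Invariant w A → ∀ (w' : Word s n) (ρ : Fin V → Fin n) →
                 FrameMap (atomFrame (atomsOf w' A ρ)) (orderFrame (orders w) (letters w'))
  atomFrameMap {w = w} {A} inv w' ρ = record
    { pos        = toℕ ∘ ρ
    ; ≤-pos      = ≤-atomsOf w' A ρ
    ; before-pos = decodeSide-pos before
    ; after-pos  = decodeSide-pos after
    ; letter-pos = λ a q → cong (λ c → letterOf c q) (trans (symbol-atomsOf w' A ρ a) (sym (at-toℕ w' (ρ a))))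
    }
    where
    length-side : ∀ side a → length (sideOrder w side a) ≡ k
    length-side after  a = order-length (letters w) (suc (toℕ a))
    length-side before a = order-length (letters w) (toℕ a)
    decodeSide-pos : ∀ side a → decodeSide (atomsOf w' A ρ) side a ≡ sideOrder w side (ρ a)
    decodeSide-pos side a = decodeOrder-isAt (sideOrder w side (ρ a)) (length-side side (ρ a))
      (λ r q → trans (auxBit-atomsOf w' A ρ a (auxIndex side r q)) (Invariant.aux-correct inv side r q (ρ a)))

  e : ℕ
  e = suc (k * k)

  module Variables (v : ℕ) where

    uᵛ targetᵛ : Fin (suc (e + v))
    uᵛ      = zero
    targetᵛ = suc (zero ↑ˡ v)

    thresholdᵛ : Fin k → Fin k → Fin (suc (e + v))
    thresholdᵛ p t = suc (suc (combine p t) ↑ˡ v)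

    freeᵛ : Fin v → Fin (suc (e + v))
    freeᵛ j = suc (e ↑ʳ j)

    certifiedMatrix : Fin v → Atoms (suc (e + v)) → Bool → (List (Fin k) → Bool) → Bool
    certifiedMatrix y E C read = pathsOK targetᵛ uᵛ ∧ C ∧ read (newOrder targetᵛ)
      where open PathCheck (atomFrame E) (freeᵛ y) thresholdᵛ

  -- The order after x is recomputed at the target x, the order before x at the
  -- target x − 1 (the largest position below x), acceptance at the last position.
  module _ where
    open Variables 2

    xᵛ yᵛ : Fin (suc (e + 2))
    xᵛ = freeᵛ zero
    yᵛ = freeᵛ (suc zero)

    auxMatrix : Side → Fin k → Fin k → Atoms (suc (e + 2)) → Bool
    auxMatrix after r q E =
      if not (yᵛ ≤ᵃ xᵛ) then auxBit xᵛ (auxIndex after r q)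
      else certifiedMatrix (suc zero) E ((targetᵛ ≤ᵃ xᵛ) ∧ (xᵛ ≤ᵃ targetᵛ)) (isAt r q)
      where open Atoms E
    auxMatrix before r q E =
      if xᵛ ≤ᵃ yᵛ then auxBit xᵛ (auxIndex before r q)
      else certifiedMatrix (suc zero) E (not (xᵛ ≤ᵃ targetᵛ) ∧ (not (xᵛ ≤ᵃ uᵛ) →ᵇ (uᵛ ≤ᵃ targetᵛ))) (isAt r q)
      where open Atoms E

  acceptMatrix : Atoms (suc (e + 1)) → Bool
  acceptMatrix E = certifiedMatrix zero E (uᵛ ≤ᵃ targetᵛ) (λ L → final (nth start L 0))
    where
    open Variables 1
    open Atoms E

  module Initial = Formulas s 0 0

  initialBit : Side × Fin k × Fin k → Bool
  initialBit (_ , r , q) = isAt r q initialOrder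

  auxUpdate : Side × Fin k × Fin k → Formula s 1 k₁ 2
  auxUpdate (side , r , q) = ∃∀ e (auxMatrix side r q)

  program : DynProg s 1 k₁
  program = record
    { init₀ = λ _ → Initial.constF (final start)
    ; init₁ = λ j → Initial.constF (initialBit (decodeIndex j))
    ; upd₀  = λ _ _ → ∃∀ e acceptMatrix
    ; upd₁  = λ j _ → auxUpdate (decodeIndex j)
    ; acc   = zero
    }

  program-Σ₂ : UpdatesΣ₂ program
  program-Σ₂ = (λ _ _ → Σ₂-∃∀ e acceptMatrix) , (λ j _ → Σ₂-auxUpdate (decodeIndex j))
    where
    Σ₂-auxUpdate : ∀ c → Σ₂ (auxUpdate c)
    Σ₂-auxUpdate (side , r , q) = Σ₂-∃∀ e (auxMatrix side r q)

  module StepCorrectness {n} (w : Word s n) (A : Aux 1 k₁ n) (inv : Invariant w A) (i : Fin n) (σ : Maybe (Fin s)) where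

    w' : Word s n
    w' = setWord w (i , σ)

    Y : ℕ
    Y = toℕ i

    agree : ∀ j → ¬ j ≡ Y → ∀ q → letters w j q ≡ letters w' j q
    agree j j≢Y q = cong (λ c → letterOf c q) (sym (at-setWord w i σ j j≢Y))

    open Update (letters w) (letters w') Y agree

    thresholdsOf : Vec (Fin n) (k * k) → Fin k → Fin k → ℕ
    thresholdsOf zs p t = toℕ (Vec.lookup zs (combine p t))

    module Guessed (zs : Vec (Fin n) (k * k)) = OrderPaths (orders w) (letters w') Y (thresholdsOf zs)

    certified : Vec (Fin n) e → Fin n → Bool → (List (Fin k) → Bool) → Bool
    certified (x ∷ zs) u C read = pathsOK (toℕ x) (toℕ u) ∧ C ∧ read (newOrder (toℕ x))
      where open Guessed zs

    certifiedMatrix-sem : ∀ {v} (ρ : Fin v → Fin n) y → ρ y ≡ i → ∀ xs u C read →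
      Variables.certifiedMatrix v y (atomsOf w' A (u VF.∷ (xs ++ᵃ ρ))) C read ≡ certified xs u C read
    certifiedMatrix-sem {v} ρ y ρy≡i (x ∷ zs) u C read =
      cong₂ (λ a b → a ∧ C ∧ read b) (pathsOK-pos targetᵛ uᵛ) (newOrder-pos targetᵛ)
      where
      open Variables v
      ρ' = u VF.∷ ((x ∷ zs) ++ᵃ ρ)
      y-pos : toℕ (ρ' (freeᵛ y)) ≡ Y
      y-pos = cong toℕ (trans (++ᵃ-↑ʳ (x ∷ zs) ρ y) ρy≡i)
      z-pos : ∀ p t → toℕ (ρ' (thresholdᵛ p t)) ≡ thresholdsOf zs p t
      z-pos p t = cong toℕ (++ᵃ-↑ˡ zs ρ (combine p t))
      open PathCheckMap (atomFrameMap inv w' ρ') (freeᵛ y) Y y-pos thresholdᵛ (thresholdsOf zs) z-pos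

    pathsOK⇒stepOK : ∀ zs (x : Fin n) → (∀ u → T (Guessed.pathsOK zs (toℕ x) (toℕ u))) →
                     ∀ u p → T (Guessed.stepOK zs (toℕ x) u p)
    pathsOK⇒stepOK zs x ok u p = byCases (u <? n)
      where
      open Guessed zs
      byCases : Dec (u < n) → T (stepOK (toℕ x) u p)
      byCases (yes u<n) = subst (λ u → T (stepOK (toℕ x) u p)) (toℕ-fromℕ< u<n) (to (T-allFin _) (ok (fromℕ< u<n)) p)
      byCases (no u≮n)  = stepOK-beyond p (<-≤-trans (toℕ<n x) (≮⇒≥ u≮n))

    record Target (C : Fin n → Fin n → Bool) : Set where
      field
        position   : ℕ
        Y≤position : Y ≤ position
        position<n : position < n
        C⇔         : ∀ x → (∀ u → T (C u x)) ⇔ toℕ x ≡ position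

    certified-⇔ : ∀ {C} (target : Target C) read →
                  (∃ λ xs → ∀ u → T (certified xs u (C u (Vec.head xs)) read))
                    ⇔ T (read (orders w' (suc (Target.position target))))
    certified-⇔ {C} target read = mk⇔ sound complete
      where
      open Target target renaming (position to t; Y≤position to Y≤t; position<n to t<n)

      newOrder-at : ∀ zs x → toℕ x ≡ t → (∀ u p → T (Guessed.stepOK zs (toℕ x) u p)) →
                    Guessed.newOrder zs (toℕ x) ≡ orders w' (suc t)
      newOrder-at zs x x≡t ok = trans (newOrder-sound (thresholdsOf zs) (toℕ x) (subst (Y ≤_) (sym x≡t) Y≤t) ok)
                                      (cong (orders w' ∘ suc) x≡t)

      sound : (∃ λ xs → ∀ u → T (certified xs u (C u (Vec.head xs)) read)) → T (read (orders w' (suc t)))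
      sound (x ∷ zs , h) = subst (T ∘ read) (newOrder-at zs x x≡t ok) (proj₂ (proj₂ (parts i)))
        where
        open Guessed zs
        parts : ∀ u → T (pathsOK (toℕ x) (toℕ u)) × T (C u x) × T (read (newOrder (toℕ x)))
        parts u = let a , bc = to T-∧ (h u) in a , to T-∧ bc
        x≡t : toℕ x ≡ t
        x≡t = to (C⇔ x) λ u → proj₁ (proj₂ (parts u))
        ok = pathsOK⇒stepOK zs x (proj₁ ∘ parts)

      complete : T (read (orders w' (suc t))) → ∃ λ xs → ∀ u → T (certified xs u (C u (Vec.head xs)) read)
      complete rt = x ∷ zs , λ u → from T-∧ (pathsOK-x u , from T-∧ (from (C⇔ x) x≡t u , read-x))
        where
        cert = certificate t Y≤t
        z = proj₁ cert
        threshold : Fin k × Fin k → Fin n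
        threshold (p , t′) = fromℕ< (≤-<-trans (proj₁ (proj₂ cert) p t′) t<n)
        zs : Vec (Fin n) (k * k)
        zs = Vec.tabulate (threshold ∘ remQuot k)
        z≡ : ∀ p t′ → z p t′ ≡ thresholdsOf zs p t′
        z≡ p t′ = sym (begin
          toℕ (Vec.lookup zs (combine p t′))          ≡⟨ cong toℕ (lookup∘tabulate (threshold ∘ remQuot k) (combine p t′)) ⟩
          toℕ (threshold (remQuot k (combine p t′)))  ≡⟨ cong (toℕ ∘ threshold) (remQuot-combine p t′) ⟩
          toℕ (threshold (p , t′))                    ≡⟨ toℕ-fromℕ< _ ⟩
          z p t′                                      ∎)
          where open ≡-Reasoning
        x = fromℕ< t<n
        x≡t : toℕ x ≡ t
        x≡t = toℕ-fromℕ< t<n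
        open Guessed zs
        ok : ∀ u p → T (stepOK (toℕ x) u p)
        ok u p = subst T (trans (stepOK-thresholds t u p) (cong (λ x → stepOK x u p) (sym x≡t))) (proj₂ (proj₂ cert) u p)
          where open PathCheckMap (idFrameMap {orderFrame (orders w) (letters w')}) Y Y refl z (thresholdsOf zs) z≡
                  renaming (stepOK-pos to stepOK-thresholds)
        pathsOK-x : ∀ u → T (pathsOK (toℕ x) (toℕ u))
        pathsOK-x u = from (T-allFin _) (ok (toℕ u))
        read-x : T (read (newOrder (toℕ x)))
        read-x = subst (T ∘ read) (sym (newOrder-at zs x x≡t ok)) rt

    update-correct : ∀ {v} (ρ : Fin v → Fin n) (G : Atoms (suc (e + v)) → Bool) c b C read new →
      (∀ xs u → G (atomsOf w' A (u VF.∷ (xs ++ᵃ ρ))) ≡ (if c then b else certified xs u (C u (Vec.head xs)) read)) →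
      (T c → b ≡ new) →
      (¬ T c → Σ (Target C) λ target → read (orders w' (suc (Target.position target))) ≡ new) →
      eval w' A (∃∀ e G) ρ ≡ new
    update-correct ρ G true b C read new G≡ unchanged _ = bool-ext
      (λ t → let xs , h = to (T-eval-∃∀ w' A e G ρ) t in subst T (unchanged _) (subst T (G≡ xs i) (h i)))
      (λ t → from (T-eval-∃∀ w' A e G ρ) (xs , λ u → subst T (sym (G≡ xs u)) (subst T (sym (unchanged _)) t)))
      where xs = Vec.replicate e i
    update-correct ρ G false b C read new G≡ _ retarget = bool-ext
      (λ t → let xs , h = to (T-eval-∃∀ w' A e G ρ) t in
             subst T read≡ (to (certified-⇔ target read) (xs , λ u → subst T (G≡ xs u) (h u))))
      (λ t → let xs , h = from (certified-⇔ target read) (subst T (sym read≡) t) in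
             from (T-eval-∃∀ w' A e G ρ) (xs , λ u → subst T (sym (G≡ xs u)) (h u)))
      where
      target = proj₁ (retarget λ ())
      read≡ = proj₂ (retarget λ ())

    module Assignment {v} (ρ : Fin v → Fin n) (x : Fin n) (zs : Vec (Fin n) (k * k)) (u : Fin n) where
      open Variables v public

      ρ' : Fin (suc (e + v)) → Fin n
      ρ' = u VF.∷ ((x ∷ zs) ++ᵃ ρ)

      E : Atoms (suc (e + v))
      E = atomsOf w' A ρ'

      open Atoms E

      free≡ : ∀ a → toℕ (ρ' (freeᵛ a)) ≡ toℕ (ρ a)
      free≡ a = cong toℕ (++ᵃ-↑ʳ (x ∷ zs) ρ a)

      ≤-free : ∀ a b → (freeᵛ a ≤ᵃ freeᵛ b) ≡ (toℕ (ρ a) ≤ᵇ toℕ (ρ b))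
      ≤-free a b = trans (≤-atomsOf w' A ρ' (freeᵛ a) (freeᵛ b)) (cong₂ _≤ᵇ_ (free≡ a) (free≡ b))

      ≤-free-target : ∀ a → (freeᵛ a ≤ᵃ targetᵛ) ≡ (toℕ (ρ a) ≤ᵇ toℕ x)
      ≤-free-target a = trans (≤-atomsOf w' A ρ' (freeᵛ a) targetᵛ) (cong (_≤ᵇ toℕ x) (free≡ a))

      ≤-target-free : ∀ a → (targetᵛ ≤ᵃ freeᵛ a) ≡ (toℕ x ≤ᵇ toℕ (ρ a))
      ≤-target-free a = trans (≤-atomsOf w' A ρ' targetᵛ (freeᵛ a)) (cong (toℕ x ≤ᵇ_) (free≡ a))

      ≤-free-u : ∀ a → (freeᵛ a ≤ᵃ uᵛ) ≡ (toℕ (ρ a) ≤ᵇ toℕ u)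
      ≤-free-u a = trans (≤-atomsOf w' A ρ' (freeᵛ a) uᵛ) (cong (_≤ᵇ toℕ u) (free≡ a))

      ≤-u-target : (uᵛ ≤ᵃ targetᵛ) ≡ (toℕ u ≤ᵇ toℕ x)
      ≤-u-target = ≤-atomsOf w' A ρ' uᵛ targetᵛ

      auxBit-free : ∀ a j → auxBit (freeᵛ a) j ≡ Aux.un A j (ρ a)
      auxBit-free a j = trans (auxBit-atomsOf w' A ρ' (freeᵛ a) j) (cong (Aux.un A j) (++ᵃ-↑ʳ (x ∷ zs) ρ a))

    module _ (a : Fin n) where

      X : ℕ
      X = toℕ a

      ρ₂ : Fin 2 → Fin n
      ρ₂ = a VF.∷ λ _ → i

      after-correct : ∀ r q → eval w' A (∃∀ e (auxMatrix after r q)) ρ₂ ≡ isAt r q (orders w' (suc X))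
      after-correct r q =
        update-correct ρ₂ (auxMatrix after r q) (not (Y ≤ᵇ X)) (isAt r q (orders w (suc X))) C (isAt r q) _
          (λ { (x ∷ zs) u → let open Assignment ρ₂ x zs u in
               if-cong₃ (cong not (≤-free (suc zero) zero))
                        (trans (auxBit-free zero (auxIndex after r q)) (Invariant.aux-correct inv after r q a))
                        (trans (cong (λ c → certifiedMatrix (suc zero) E c (isAt r q))
                                     (cong₂ _∧_ (≤-target-free zero) (≤-free-target zero)))
                               (certifiedMatrix-sem ρ₂ (suc zero) refl (x ∷ zs) u (C u x) (isAt r q))) })
          (λ X<Y → cong (isAt r q) (order-below (suc X) (to T-not-≤ᵇ X<Y)))
          (λ X≮Y → target (≤ᵇ⇒≤ Y X (¬T-not⇒T X≮Y)) , refl)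
        where
        C : Fin n → Fin n → Bool
        C u x = (toℕ x ≤ᵇ X) ∧ (X ≤ᵇ toℕ x)
        target : Y ≤ X → Target C
        target Y≤X = record
          { position   = X
          ; Y≤position = Y≤X
          ; position<n = toℕ<n a
          ; C⇔         = λ x → mk⇔
              (λ h → let x≤X , X≤x = to T-∧ (h i) in ≤-antisym (≤ᵇ⇒≤ _ _ x≤X) (≤ᵇ⇒≤ _ _ X≤x))
              (λ x≡X u → from T-∧ (≤⇒≤ᵇ (≤-reflexive x≡X) , ≤⇒≤ᵇ (≤-reflexive (sym x≡X))))
          }

      before-correct : ∀ r q → eval w' A (∃∀ e (auxMatrix before r q)) ρ₂ ≡ isAt r q (orders w' X)
      before-correct r q =
        update-correct ρ₂ (auxMatrix before r q) (X ≤ᵇ Y) (isAt r q (orders w X)) C (isAt r q) _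
          (λ { (x ∷ zs) u → let open Assignment ρ₂ x zs u in
               if-cong₃ (≤-free zero (suc zero))
                        (trans (auxBit-free zero (auxIndex before r q)) (Invariant.aux-correct inv before r q a))
                        (trans (cong (λ c → certifiedMatrix (suc zero) E c (isAt r q))
                                     (cong₂ (λ b c → not b ∧ c) (≤-free-target zero)
                                            (cong₂ (λ b c → not b →ᵇ c) (≤-free-u zero) ≤-u-target)))
                               (certifiedMatrix-sem ρ₂ (suc zero) refl (x ∷ zs) u (C u x) (isAt r q))) })
          (λ X≤Y → cong (isAt r q) (order-below X (≤ᵇ⇒≤ X Y X≤Y)))
          (λ X≰Y → let Y<X = ≰⇒> (X≰Y ∘ ≤⇒≤ᵇ) in target Y<X , cong (isAt r q ∘ orders w') (m+[n∸m]≡n (0<X Y<X)))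
        where
        C : Fin n → Fin n → Bool
        C u x = not (X ≤ᵇ toℕ x) ∧ (not (X ≤ᵇ toℕ u) →ᵇ (toℕ u ≤ᵇ toℕ x))
        0<X : Y < X → 0 < X
        0<X = ≤-<-trans z≤n
        unpack : ∀ {x} → (∀ u → T (C u x)) → toℕ x < X × (∀ u → toℕ u < X → toℕ u ≤ toℕ x)
        unpack h = to T-not-≤ᵇ (proj₁ (to T-∧ (h i)))
                 , λ u u<X → ≤ᵇ⇒≤ _ _ (to T-→ᵇ (proj₂ (to T-∧ (h u))) (from T-not-≤ᵇ u<X))
        pack : ∀ {x} → toℕ x < X × (∀ u → toℕ u < X → toℕ u ≤ toℕ x) → ∀ u → T (C u x)
        pack (x<X , below) u =
          from T-∧ (from T-not-≤ᵇ x<X , from T-→ᵇ λ t → ≤⇒≤ᵇ (below u (to T-not-≤ᵇ t)))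
        target : Y < X → Target C
        target Y<X = record
          { position   = X ∸ 1
          ; Y≤position = <⇒≤pred Y<X
          ; position<n = ≤-<-trans (m∸n≤m X 1) (toℕ<n a)
          ; C⇔         = λ x → mk⇔ (to (largestBelow (0<X Y<X) (<⇒≤ (toℕ<n a)) x) ∘ unpack)
                                   (pack ∘ from (largestBelow (0<X Y<X) (<⇒≤ (toℕ<n a)) x))
          }

    ρ₁ : Fin 1 → Fin n
    ρ₁ _ = i

    accept-correct : eval w' A (∃∀ e acceptMatrix) ρ₁ ≡ accepting w'
    accept-correct = update-correct ρ₁ acceptMatrix false false C read _
      (λ { (x ∷ zs) u → let open Assignment ρ₁ x zs u in
           trans (cong (λ c → certifiedMatrix zero E c read) ≤-u-target)
                 (certifiedMatrix-sem ρ₁ zero refl (x ∷ zs) u (C u x) read) })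
      (λ ())
      (λ _ → target , cong (read ∘ orders w') (m+[n∸m]≡n 0<n))
      where
      C : Fin n → Fin n → Bool
      C u x = toℕ u ≤ᵇ toℕ x
      read : List (Fin k) → Bool
      read L = final (nth start L 0)
      0<n : 0 < n
      0<n = ≤-<-trans z≤n (toℕ<n i)
      last⇔ : ∀ x → (toℕ x < n × (∀ u → toℕ u < n → toℕ u ≤ toℕ x)) ⇔ toℕ x ≡ n ∸ 1
      last⇔ = largestBelow 0<n ≤-refl
      target : Target C
      target = record
        { position   = n ∸ 1
        ; Y≤position = <⇒≤pred (toℕ<n i)
        ; position<n = ≤-reflexive (m+[n∸m]≡n 0<n)
        ; C⇔         = λ x → mk⇔ (λ h → to (last⇔ x) (toℕ<n x , λ u _ → ≤ᵇ⇒≤ _ _ (h u)))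
                                 (λ x≡ u → ≤⇒≤ᵇ (proj₂ (from (last⇔ x) x≡) u (toℕ<n u)))
        }

  step-invariant : ∀ {n} {w : Word s n} {A} → Invariant w A → ∀ c →
                   Invariant (proj₁ (step program (w , A) c)) (proj₂ (step program (w , A) c))
  step-invariant {w = w} {A} inv (i , σ) = record
    { aux-correct = λ side r q a →
        trans (cong (λ c → eval w' A (auxUpdate c) (a VF.∷ λ _ → i)) (decodeIndex-auxIndex side r q)) (by-side side r q a)
    ; acc-correct = accept-correct
    }
    where
    open StepCorrectness w A inv i σ
    by-side : ∀ side r q a → eval w' A (auxUpdate (side , r , q)) (a VF.∷ λ _ → i) ≡ isAt r q (sideOrder w' side a)
    by-side after  r q a = after-correct a r q
    by-side before r q a = before-correct a r q

  orders-empty : ∀ {n} j → orders (emptyWord {s} {n}) j ≡ initialOrder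
  orders-empty {n} j = order-id _ (λ j q → cong (λ c → letterOf c q) (at-empty {n} j)) j

  initial-invariant : ∀ n → Invariant (emptyWord {s} {n}) (initAux program n)
  initial-invariant n = record
    { aux-correct = λ side r q a → trans (Initial.eval-constF emptyWord noAux _ _)
        (trans (cong initialBit (decodeIndex-auxIndex side r q)) (cong (isAt r q) (sym (orders-side side a))))
    ; acc-correct = trans (Initial.eval-constF emptyWord noAux _ _)
        (cong (λ L → final (nth start L 0)) (sym (orders-empty {n} n)))
    }
    where
    orders-side : ∀ side a → sideOrder emptyWord side a ≡ initialOrder
    orders-side after  a = orders-empty {n} (suc (toℕ a))
    orders-side before a = orders-empty {n} (toℕ a)

  invariant-foldl : ∀ {n} cs (st : Word s n × Aux 1 k₁ n) → Invariant (proj₁ st) (proj₂ st) →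
                    Invariant (proj₁ (foldl (step program) st cs)) (proj₂ (foldl (step program) st cs))
  invariant-foldl []       st inv = inv
  invariant-foldl (c ∷ cs) st inv = invariant-foldl cs (step program st c) (step-invariant inv c)

  accepting-accepts : ∀ {n} (w : Word s n) → accepting w ≡ accepts D (wordOf w)
  accepting-accepts {n} w with orders w n | order-head (letters w) n
  ... | _ | _ , refl = reached-accepts w

  maintains : (L : List (Fin s) → Set) → (∀ v → L v ⇔ (accepts D v ≡ true)) → Maintains program L
  maintains L L⇔ n cs = mk⇔ (λ acc → from (L⇔ _) (trans (sym nul≡) acc)) (λ l → trans nul≡ (to (L⇔ _) l))
    where
    st = run program n cs
    nul≡ : Aux.nul (proj₂ st) zero ≡ accepts D (wordOf (proj₁ st))
    nul≡ = trans (Invariant.acc-correct (invariant-foldl cs _ (initial-invariant n))) (accepting-accepts (proj₁ st))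

open Defs

theorem1 : (s : ℕ) (L : List (Fin s) → Set) → Regular L → InUDynΣ₂ L
theorem1 s L (D , L⇔) = 1 , k₁ , program , program-Σ₂ , maintains L L⇔
  where open Construction s D
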